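{- Let $x\in Q$ have minimal even expansion $x=[\overline{a_1,\ldots,a_{2n}}]$, and let $\gamma$ be one of the two oriented primitive closed geodesics on $T^1\mathcal M$ corresponding to $x$. Then $$|\Psi(A_\gamma)|=\Big|\sum_{j=1}^{2n}(-1)^ja_j\Big|=|\mathrm{Alt}(x)|.$$
   Context: Continued fractions: $[\overline{a_1,\ldots,a_m}]$ ($a_i\in\mathbb N$) is the purely periodic continued fraction $\frac1{a_1+\frac1{a_2+\cdots}}$ repeating $(a_1,\dots,a_m)$; $Q$ is the set of such numbers in $(0,1)$ (quadratic irrationals $x\in(0,1)$ with Galois conjugate $\bar x<-1$). The minimal expansion has the shortest period $m$; the minimal even expansion is $[\overline{a_1,\dots,a_{2n}}]$ with $2n=m$ if $m$ is even and $2n=2m$ (minimal block written twice) if $m$ odd; $\mathrm{Alt}(x)=\sum_{j=1}^{2n}(-1)^ja_j$ for this expansion. Geodesics: $\mathbb H$ is the upper half plane, $\mathcal M=\mathrm{PSL}_2(\mathbb Z)\backslash\mathbb H$, $T^1\mathcal M$ its unit tangent bundle with the geodesic flow. Oriented primitive closed geodesics $\gamma$ correspond bijectively to conjugacy classes $\{A_\gamma\}$ of primitive hyperbolic elements of $\mathrm{PSL}_2(\mathbb Z)$, a lift of $\gamma$ to $\mathbb H$ joining the fixed points of an element of the class. Orientation reversal $(z,\xi)\mapsto(-\bar z,-\bar\xi)$ sends $\gamma$ to $\bar\gamma$. The point $x\in Q$ (or its orbit under the Gauss map $x\mapsto\{1/x\}$) corresponds to the pair $\{\gamma,\bar\gamma\}$,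 where $\gamma$ is the oriented primitive closed geodesic having a lift to $\mathbb H$ oriented from $\bar x$ to $x$. $\Psi$ is the Rademacher function: with $S=\begin{pmatrix}0&-1\\1&0\end{pmatrix}$, $U=\begin{pmatrix}1&-1\\1&0\end{pmatrix}$, each element of $\mathrm{PSL}_2(\mathbb Z)$ is conjugate to $S$, $U^{\pm1}$ or $SU^{\epsilon_1}\cdots SU^{\epsilon_k}$ ($\epsilon_j=\pm1$), and $\Psi(S)=0$, $\Psi(U^{\pm1})=\mp2$, $\Psi(SU^{\epsilon_1}\cdots SU^{\epsilon_k})=\sum\epsilon_j$, $\Psi$ constant on conjugacy classes. -}

module Defs where

open import Data.Bool using (Bool; true; false; if_then_else_)
open import Data.Nat as ℕ using (ℕ; zero; suc)
open import Data.Integer using (ℤ; +_; -_; _+_; _-_; _*_; _<_; ∣_∣; 0ℤ; 1ℤ)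
open import Data.List using (List; []; _∷_; _++_; length; concat; replicate; foldr)
open import Data.Product using (Σ; _×_; ∃)
open import Data.Sum using (_⊎_)
open import Relation.Binary.PropositionalEquality using (_≡_)

-- 2×2 integer matrices  (mat a b c d  =  [[a , b] , [c , d]])

record M2 : Set where
  constructor mat
  field
    a b c d : ℤ
open M2 public

infixl 7 _·_
_·_ : M2 → M2 → M2
mat a b c d · mat a' b' c' d' =
  mat (a * a' + b * c') (a * b' + b * d') (c * a' + d * c') (c * b' + d * d')

neg : M2 → M2
neg (mat a b c d) = mat (- a) (- b) (- c) (- d)

det : M2 → ℤ
det (mat a b c d) = a * d - b * c

tr : M2 → ℤ
tr (mat a b c d) = a + d

I : M2
I = mat 1ℤ 0ℤ 0ℤ 1ℤ

pow : M2 → ℕ → M2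
pow A zero    = I
pow A (suc k) = A · pow A k

-- Equality in PSL₂(ℤ) of two SL₂(ℤ) representatives
PEq : M2 → M2 → Set
PEq A B = (A ≡ B) ⊎ (A ≡ neg B)

Conj : M2 → M2 → Set
Conj A B = Σ M2 λ g → (det g ≡ 1ℤ) × PEq (g · A) (B · g)

S U Uinv : M2
S    = mat 0ℤ (- 1ℤ) 1ℤ 0ℤ
U    = mat 1ℤ (- 1ℤ) 1ℤ 0ℤ
Uinv = mat 0ℤ 1ℤ (- 1ℤ) 1ℤ

data Sgn : Set where
  pl mi : Sgn

Upow : Sgn → M2
Upow pl = U
Upow mi = Uinv

sgnℤ : Sgn → ℤ
sgnℤ pl = 1ℤ
sgnℤ mi = - 1ℤ

word : List Sgn → M2
word []       = I
word (e ∷ es) = S · Upow e · word es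

sumSgn : List Sgn → ℤ
sumSgn = foldr (λ e s → sgnℤ e + s) 0ℤ

-- HasΨ A k  :  A is conjugate in PSL₂(ℤ) to one of the normal forms, whose
-- Ψ-value is k.
HasΨ : M2 → ℤ → Set
HasΨ A k =
  (Conj A S × k ≡ 0ℤ)
  ⊎ (Conj A U × k ≡ - (+ 2))
  ⊎ (Conj A Uinv × k ≡ + 2)
  ⊎ (Σ (List Sgn) λ es → (es ≡ [] → Data.Empty.⊥) × Conj A (word es) × k ≡ sumSgn es)
  where import Data.Empty

Hyperbolic : M2 → Set
Hyperbolic A = 2 ℕ.< ∣ tr A ∣

Primitive : M2 → Set
Primitive A = (B : M2) (k : ℕ) → det B ≡ 1ℤ → PEq A (pow B k) → k ≡ 1

MinimalBlock : List ℕ → Set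
MinimalBlock as = (w : List ℕ) (d : ℕ) → as ≡ concat (replicate d w) → d ≡ 1

isEven : ℕ → Bool
isEven zero          = true
isEven (suc zero)    = false
isEven (suc (suc n)) = isEven n

evenExp : List ℕ → List ℕ
evenExp as = if isEven (length as) then as else as ++ as

alt : List ℕ → ℤ
alt []              = 0ℤ
alt (x ∷ [])        = - (+ x)
alt (x ∷ y ∷ rest)  = - (+ x) + (+ y) + alt rest

-- z ↦ 1/(a+z)
G : ℕ → M2
G a = mat 0ℤ 1ℤ 1ℤ (+ a)

-- z ↦ g_{a₁} ∘ ⋯ ∘ g_{aₖ} (z); for an even block this lies in SL₂(ℤ), has
-- positive trace, its attracting fixed point is x = [a₁,…,aₖ repeated]
-- and its repelling fixed point is the conjugate x̄.
cfMat : List ℕ → M2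
cfMat []       = I
cfMat (a ∷ as) = G a · cfMat as

-- conjugation by the reflection z ↦ -z̄ (R = diag(1,-1))
reflect : M2 → M2
reflect (mat a b c d) = mat a (- b) (- c) d

-- For A = mat a b c d the fixed points are the roots of c z² + (d - a) z - b.
-- If tr A > 0, the attracting fixed point is ((a-d)+√Δ)/(2c).
-- A (up to sign) has the same repelling/attracting fixed points as B
-- (tr B > 0) iff, for the sign representative of A with positive trace,
-- the fixed-point polynomial is a POSITIVE rational multiple of that of B.

signed : Sgn → M2 → M2
signed pl A = A
signed mi A = neg A

SameOrientedAxis : M2 → M2 → Set
SameOrientedAxis A B =
  Σ Sgn λ σ → let A' = signed σ A in
    (0ℤ < tr A') ×
    Σ ℕ λ u → Σ ℕ λ v → (0 ℕ.< u) × (0 ℕ.< v) ×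
      ((+ u) * c A' ≡ (+ v) * c B) ×
      ((+ u) * (d A' - a A') ≡ (+ v) * (d B - a B)) ×
      ((+ u) * b A' ≡ (+ v) * b B)

-- the lift of γ goes from x̄ to x;  the lift of γ̄ goes from -x̄ to -x.
geodesicMat : Bool → List ℕ → M2
geodesicMat false as = cfMat (evenExp as)
geodesicMat true  as = reflect (cfMat (evenExp as))

-- Write the period of x as the word W = L^a₁ R^a₂ ⋯ R^a₂ₙ in L = [[1,0],[1,1]] and
-- R = [[1,1],[0,1]]; then W is the matrix of the minimal even expansion and Alt(x) is the
-- number of Rs minus the number of Ls in W. Since S U = -S⁻¹ R S and S U⁻¹ = S⁻¹ L S, a
-- positive word is conjugate to the normal form of Ψ that reads R, L as U, U⁻¹, so its Ψ-value
-- is #R − #L. The sign representative of A with positive trace has nonnegative entries and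
-- commutes with W, so it is a positive word V with V W = W V; both are powers of one word, and
-- primitivity of A together with minimality of the period give A = ±W (for γ̄, the reflection
-- z ↦ -z̄ exchanges L and R up to conjugation by S). Ψ is well defined on these classes because
-- conjugate hyperbolic positive words ⟦p⟧, ⟦q⟧ have the same #R − #L: if g ⟦p⟧ = ⟦q⟧ g, then
-- h = g ⟦pⁿ⟧ still conjugates them and has one-signed rows for large n; a nonnegative h is
-- itself a word w with w p = q w, and rows of opposite signs would make ⟦q⟧ diagonal.

module Submission where

open import Defs
open import Data.Bool using (Bool; true; false; if_then_else_)
open import Data.Empty using (⊥; ⊥-elim)
open import Data.Integer as ℤ using (ℤ; +_; -[1+_]; -_; _+_; _-_; _*_; ∣_∣; 0ℤ; 1ℤ; +≤+; -≤+)
import Data.Integer.Properties as ℤₚ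
open import Data.Integer.Tactic.RingSolver using (solve-∀)
open import Data.List using (List; []; _∷_; _++_; [_]; length; concat; replicate; map; reverse)
import Data.List.Properties as Listₚ
open import Data.List.Relation.Unary.All using (All; []; _∷_)
import Data.List.Relation.Unary.All.Properties as Allₚ
open import Data.Nat as ℕ using (ℕ; zero; suc; z≤n; s≤s; _<_; _≤_; _≤?_)
open import Data.Nat.Induction using (<-wellFounded)
import Data.Nat.Properties as ℕₚ
import Data.Nat.Tactic.RingSolver as ℕ-Solver
open import Data.Product using (Σ; ∃; _×_; _,_; proj₁; proj₂)
open import Data.Sum using (_⊎_; inj₁; inj₂; [_,_]′)
open import Function using (id; _∘_; _∘′_)
open import Induction.WellFounded using (Acc; acc)
open import Level using (0ℓ)
open import Relation.Binary.Bundles using (Setoid)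
open import Relation.Binary.PropositionalEquality hiding ([_])
open import Relation.Nullary using (¬_; yes; no)

-- Integer 2×2 matrices up to sign and conjugacy

nonneg*nonpos≤0 : ∀ {x y} → 0ℤ ℤ.≤ x → y ℤ.≤ 0ℤ → x * y ℤ.≤ 0ℤ
nonneg*nonpos≤0 {x} {y} 0≤x y≤0 =
  subst (x * y ℤ.≤_) (ℤₚ.*-zeroʳ x) (ℤₚ.*-monoˡ-≤-nonNeg x {{ℤ.nonNegative 0≤x}} y≤0)

0≤* : ∀ {x y} → 0ℤ ℤ.≤ x → 0ℤ ℤ.≤ y → 0ℤ ℤ.≤ x * y
0≤* {+ m} {+ n} _ _ = subst (0ℤ ℤ.≤_) (ℤₚ.pos-* m n) (+≤+ z≤n)

det≢1 : ∀ a b c d → a * d ℤ.≤ 0ℤ → 0ℤ ℤ.≤ b * c → a * d - b * c ≢ 1ℤ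
det≢1 a b c d ad≤0 0≤bc det≡1 = 1≰0 (subst (ℤ._≤ 0ℤ) det≡1 (ℤₚ.+-mono-≤ ad≤0 (ℤₚ.neg-mono-≤ 0≤bc)))
  where
  1≰0 : ¬ (1ℤ ℤ.≤ 0ℤ)
  1≰0 (+≤+ ())

mat-cong : ∀ {a b c d a′ b′ c′ d′} → a ≡ a′ → b ≡ b′ → c ≡ c′ → d ≡ d′ →
           mat a b c d ≡ mat a′ b′ c′ d′
mat-cong refl refl refl refl = refl

·-assoc : ∀ X Y Z → (X · Y) · Z ≡ X · (Y · Z)
·-assoc (mat a b c d) (mat e f g h) (mat i j k l) =
  mat-cong (entry a b e f g h i k) (entry a b e f g h j l) (entry c d e f g h i k) (entry c d e f g h j l)
  where
  entry : ∀ a b e f g h i k → (a * e + b * g) * i + (a * f + b * h) * k ≡ a * (e * i + f * k) + b * (g * i + h * k)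
  entry = solve-∀

·-identityˡ : ∀ X → I · X ≡ X
·-identityˡ (mat a b c d) = mat-cong (entry a c) (entry b d) (entry′ a c) (entry′ b d)
  where
  entry : ∀ x y → 1ℤ * x + 0ℤ * y ≡ x
  entry = solve-∀
  entry′ : ∀ x y → 0ℤ * x + 1ℤ * y ≡ y
  entry′ = solve-∀

·-identityʳ : ∀ X → X · I ≡ X
·-identityʳ (mat a b c d) = mat-cong (entry a b) (entry′ a b) (entry c d) (entry′ c d)
  where
  entry : ∀ x y → x * 1ℤ + y * 0ℤ ≡ x
  entry = solve-∀
  entry′ : ∀ x y → x * 0ℤ + y * 1ℤ ≡ y
  entry′ = solve-∀

det-· : ∀ X Y → det (X · Y) ≡ det X * det Y
det-· (mat a b c d) (mat e f g h) = identity a b c d e f g h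
  where
  identity : ∀ a b c d e f g h →
    (a * e + b * g) * (c * f + d * h) - (a * f + b * h) * (c * e + d * g) ≡ (a * d - b * c) * (e * h - f * g)
  identity = solve-∀

det-·-unimodular : ∀ {X Y} → det X ≡ 1ℤ → det Y ≡ 1ℤ → det (X · Y) ≡ 1ℤ
det-·-unimodular {X} {Y} dX dY = trans (det-· X Y) (cong₂ _*_ dX dY)

neg-distribˡ-· : ∀ X Y → neg (X · Y) ≡ neg X · Y
neg-distribˡ-· (mat a b c d) (mat e f g h) =
  mat-cong (entry a b e g) (entry a b f h) (entry c d e g) (entry c d f h)
  where
  entry : ∀ a b e g → - (a * e + b * g) ≡ (- a) * e + (- b) * g
  entry = solve-∀

neg-distribʳ-· : ∀ X Y → neg (X · Y) ≡ X · neg Y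
neg-distribʳ-· (mat a b c d) (mat e f g h) =
  mat-cong (entry a b e g) (entry a b f h) (entry c d e g) (entry c d f h)
  where
  entry : ∀ a b e g → - (a * e + b * g) ≡ a * (- e) + b * (- g)
  entry = solve-∀

neg-involutive : ∀ X → neg (neg X) ≡ X
neg-involutive (mat a b c d) =
  mat-cong (ℤₚ.neg-involutive a) (ℤₚ.neg-involutive b) (ℤₚ.neg-involutive c) (ℤₚ.neg-involutive d)

tr-neg : ∀ X → tr (neg X) ≡ - tr X
tr-neg (mat a b c d) = sym (ℤₚ.neg-distrib-+ a d)

∣tr∣-neg : ∀ X → ∣ tr (neg X) ∣ ≡ ∣ tr X ∣
∣tr∣-neg X = trans (cong ∣_∣ (tr-neg X)) (ℤₚ.∣-i∣≡∣i∣ (tr X))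

det-neg : ∀ X → det (neg X) ≡ det X
det-neg (mat a b c d) = identity a b c d
  where
  identity : ∀ a b c d → (- a) * (- d) - (- b) * (- c) ≡ a * d - b * c
  identity = solve-∀

tr-comm : ∀ X Y → tr (X · Y) ≡ tr (Y · X)
tr-comm (mat a b c d) (mat e f g h) = identity a b c d e f g h
  where
  identity : ∀ a b c d e f g h → (a * e + b * g) + (c * f + d * h) ≡ (e * a + f * c) + (g * b + h * d)
  identity = solve-∀

adj : M2 → M2
adj (mat a b c d) = mat d (- b) (- c) a

det-adj : ∀ X → det (adj X) ≡ det X
det-adj (mat a b c d) = identity a b c d
  where
  identity : ∀ a b c d → d * a - (- b) * (- c) ≡ a * d - b * c
  identity = solve-∀

adj-inverseˡ : ∀ X → det X ≡ 1ℤ → adj X · X ≡ I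
adj-inverseˡ (mat a b c d) det≡1 =
  mat-cong (trans (diagonal a b c d) det≡1) (off₁ a b c d) (off₂ a b c d) (trans (diagonal′ a b c d) det≡1)
  where
  diagonal : ∀ a b c d → d * a + (- b) * c ≡ a * d - b * c
  diagonal = solve-∀
  off₁ : ∀ a b c d → d * b + (- b) * d ≡ 0ℤ
  off₁ = solve-∀
  off₂ : ∀ a b c d → (- c) * a + a * c ≡ 0ℤ
  off₂ = solve-∀
  diagonal′ : ∀ a b c d → (- c) * b + a * d ≡ a * d - b * c
  diagonal′ = solve-∀

adj-inverseʳ : ∀ X → det X ≡ 1ℤ → X · adj X ≡ I
adj-inverseʳ (mat a b c d) det≡1 =
  mat-cong (trans (diagonal a b c d) det≡1) (off₁ a b c d) (off₂ a b c d) (trans (diagonal′ a b c d) det≡1)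
  where
  diagonal : ∀ a b c d → a * d + b * (- c) ≡ a * d - b * c
  diagonal = solve-∀
  off₁ : ∀ a b c d → a * (- b) + b * a ≡ 0ℤ
  off₁ = solve-∀
  off₂ : ∀ a b c d → c * d + d * (- c) ≡ 0ℤ
  off₂ = solve-∀
  diagonal′ : ∀ a b c d → c * (- b) + d * a ≡ a * d - b * c
  diagonal′ = solve-∀

tr-conj : ∀ {g A B} → det g ≡ 1ℤ → g · A ≡ B · g → tr A ≡ tr B
tr-conj {g} {A} {B} dg gA≡Bg = begin
  tr A                    ≡⟨ cong tr (sym (·-identityˡ A)) ⟩
  tr (I · A)              ≡⟨ cong (λ u → tr (u · A)) (sym (adj-inverseˡ g dg)) ⟩
  tr ((adj g · g) · A)    ≡⟨ cong tr (·-assoc (adj g) g A) ⟩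
  tr (adj g · (g · A))    ≡⟨ cong (λ u → tr (adj g · u)) gA≡Bg ⟩
  tr (adj g · (B · g))    ≡⟨ cong tr (sym (·-assoc (adj g) B g)) ⟩
  tr ((adj g · B) · g)    ≡⟨ tr-comm (adj g · B) g ⟩
  tr (g · (adj g · B))    ≡⟨ cong tr (sym (·-assoc g (adj g) B)) ⟩
  tr ((g · adj g) · B)    ≡⟨ cong (λ u → tr (u · B)) (adj-inverseʳ g dg) ⟩
  tr (I · B)              ≡⟨ cong tr (·-identityˡ B) ⟩
  tr B                    ∎
  where open ≡-Reasoning

PEq-refl : ∀ {X} → PEq X X
PEq-refl = inj₁ refl

PEq-sym : ∀ {X Y} → PEq X Y → PEq Y X
PEq-sym (inj₁ refl) = inj₁ refl
PEq-sym {Y = Y} (inj₂ refl) = inj₂ (sym (neg-involutive Y))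

PEq-trans : ∀ {X Y Z} → PEq X Y → PEq Y Z → PEq X Z
PEq-trans (inj₁ refl) q = q
PEq-trans (inj₂ refl) (inj₁ refl) = inj₂ refl
PEq-trans (inj₂ refl) (inj₂ refl) = inj₁ (neg-involutive _)

PEq-setoid : Setoid 0ℓ 0ℓ
PEq-setoid = record
  { Carrier = M2
  ; _≈_ = PEq
  ; isEquivalence = record { refl = PEq-refl ; sym = PEq-sym ; trans = PEq-trans }
  }

·-cong : ∀ {X X′ Y Y′} → PEq X X′ → PEq Y Y′ → PEq (X · Y) (X′ · Y′)
·-cong (inj₁ refl) (inj₁ refl) = inj₁ refl
·-cong {X′ = X′} {Y′ = Y′} (inj₁ refl) (inj₂ refl) = inj₂ (sym (neg-distribʳ-· X′ Y′))
·-cong {X′ = X′} {Y′ = Y′} (inj₂ refl) (inj₁ refl) = inj₂ (sym (neg-distribˡ-· X′ Y′))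
·-cong {X′ = X′} {Y′ = Y′} (inj₂ refl) (inj₂ refl) = inj₁ (begin
  neg X′ · neg Y′         ≡⟨ sym (neg-distribˡ-· X′ (neg Y′)) ⟩
  neg (X′ · neg Y′)       ≡⟨ cong neg (sym (neg-distribʳ-· X′ Y′)) ⟩
  neg (neg (X′ · Y′))     ≡⟨ neg-involutive (X′ · Y′) ⟩
  X′ · Y′                 ∎)
  where open ≡-Reasoning

·-congˡ : ∀ Z {X Y} → PEq X Y → PEq (Z · X) (Z · Y)
·-congˡ Z = ·-cong (PEq-refl {Z})

·-congʳ : ∀ Z {X Y} → PEq X Y → PEq (X · Z) (Y · Z)
·-congʳ Z p = ·-cong p (PEq-refl {Z})

∣tr∣-Conj : ∀ {A B} → Conj A B → ∣ tr A ∣ ≡ ∣ tr B ∣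
∣tr∣-Conj {A} {B} (g , dg , inj₁ gA≡Bg) = cong ∣_∣ (tr-conj {g} {A} {B} dg gA≡Bg)
∣tr∣-Conj {A} {B} (g , dg , inj₂ gA≡-Bg) =
  trans (cong ∣_∣ (tr-conj {g} {A} {neg B} dg (trans gA≡-Bg (neg-distribˡ-· B g)))) (∣tr∣-neg B)

PEq⇒Conj : ∀ {A B} → PEq A B → Conj A B
PEq⇒Conj {A} {B} p = I , refl , (begin
  I · A   ≡⟨ ·-identityˡ A ⟩
  A       ≈⟨ p ⟩
  B       ≡⟨ ·-identityʳ B ⟨
  B · I   ∎)
  where open import Relation.Binary.Reasoning.Setoid PEq-setoid

Conj-sym : ∀ {A B} → Conj A B → Conj B A
Conj-sym {A} {B} (g , dg , gA≈Bg) = adj g , trans (det-adj g) dg , (begin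
  adj g · B                     ≡⟨ ·-identityʳ (adj g · B) ⟨
  adj g · B · I                 ≡⟨ cong (λ u → adj g · B · u) (adj-inverseʳ g dg) ⟨
  adj g · B · (g · adj g)       ≡⟨ reassoc ⟩
  adj g · (B · g) · adj g       ≈⟨ ·-congʳ (adj g) (·-congˡ (adj g) (PEq-sym gA≈Bg)) ⟩
  adj g · (g · A) · adj g       ≡⟨ cong (_· adj g) (sym (·-assoc (adj g) g A)) ⟩
  adj g · g · A · adj g         ≡⟨ cong (λ u → u · A · adj g) (adj-inverseˡ g dg) ⟩
  I · A · adj g                 ≡⟨ cong (_· adj g) (·-identityˡ A) ⟩
  A · adj g                     ∎)
  where
  open import Relation.Binary.Reasoning.Setoid PEq-setoid
  reassoc : adj g · B · (g · adj g) ≡ adj g · (B · g) · adj g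
  reassoc = trans (sym (·-assoc (adj g · B) g (adj g))) (cong (_· adj g) (·-assoc (adj g) B g))

Conj-trans : ∀ {A B C} → Conj A B → Conj B C → Conj A C
Conj-trans {A} {B} {C} (g , dg , gA≈Bg) (h , dh , hB≈Ch) = h · g , det-·-unimodular {h} {g} dh dg , (begin
  h · g · A       ≡⟨ ·-assoc h g A ⟩
  h · (g · A)     ≈⟨ ·-congˡ h gA≈Bg ⟩
  h · (B · g)     ≡⟨ ·-assoc h B g ⟨
  h · B · g       ≈⟨ ·-congʳ g hB≈Ch ⟩
  C · h · g       ≡⟨ ·-assoc C h g ⟩
  C · (h · g)     ∎)
  where open import Relation.Binary.Reasoning.Setoid PEq-setoid

Conj-refl : ∀ {A} → Conj A A
Conj-refl {A} = PEq⇒Conj (PEq-refl {A})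

Conj-setoid : Setoid 0ℓ 0ℓ
Conj-setoid = record
  { Carrier = M2
  ; _≈_ = Conj
  ; isEquivalence = record
    { refl = Conj-refl ; sym = λ {A} {B} → Conj-sym {A} {B} ; trans = λ {A} {B} {C} → Conj-trans {A} {B} {C} }
  }

-- Combinatorics on words

module _ {A : Set} where

  infixl 8 _^_
  _^_ : List A → ℕ → List A
  w ^ n = concat (replicate n w)

  ^-one : ∀ w → w ^ 1 ≡ w
  ^-one = Listₚ.++-identityʳ

  []^ : ∀ n → [] ^ n ≡ []
  []^ zero    = refl
  []^ (suc n) = []^ n

  ^-+ : ∀ i j w → w ^ i ++ w ^ j ≡ w ^ (i ℕ.+ j)
  ^-+ zero    j w = refl
  ^-+ (suc i) j w = trans (Listₚ.++-assoc w (w ^ i) (w ^ j)) (cong (w ++_) (^-+ i j w))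

  ^-suc-comm : ∀ n w → w ++ w ^ n ≡ w ^ n ++ w
  ^-suc-comm zero    w = Listₚ.++-identityʳ w
  ^-suc-comm (suc n) w = trans (cong (w ++_) (^-suc-comm n w)) (sym (Listₚ.++-assoc w (w ^ n) w))

  length-^ : ∀ n w → length (w ^ n) ≡ n ℕ.* length w
  length-^ zero    w = refl
  length-^ (suc n) w = trans (Listₚ.length-++ w) (cong (length w ℕ.+_) (length-^ n w))

  ≤-length-^ : ∀ n w → w ≢ [] → n ≤ length (w ^ n)
  ≤-length-^ n []      w≢[] = ⊥-elim (w≢[] refl)
  ≤-length-^ n (x ∷ w) _    = subst (n ≤_) (sym (length-^ n (x ∷ w)))
    (subst (_≤ n ℕ.* length (x ∷ w)) (ℕₚ.*-identityʳ n) (ℕₚ.*-monoʳ-≤ n (s≤s z≤n)))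

  ++-prefix : ∀ a b c d → a ++ b ≡ c ++ d → length a ≤ length c →
              Σ (List A) λ m → c ≡ a ++ m × b ≡ m ++ d
  ++-prefix []      b c       d eq _       = c , refl , eq
  ++-prefix (x ∷ a) b (y ∷ c) d eq (s≤s ≤) with Listₚ.∷-injective eq
  ... | refl , eq′ with ++-prefix a b c d eq′ ≤
  ...   | m , c≡a++m , b≡m++d = m , cong (x ∷_) c≡a++m , b≡m++d

  ++-overlap : ∀ a b c d → a ++ b ≡ c ++ d →
               (Σ (List A) λ m → c ≡ a ++ m × b ≡ m ++ d) ⊎ (Σ (List A) λ m → a ≡ c ++ m × d ≡ m ++ b)
  ++-overlap a b c d eq with length a ≤? length c
  ... | yes ≤ = inj₁ (++-prefix a b c d eq ≤)
  ... | no ≰  = inj₂ (++-prefix c d a b (sym eq) (ℕₚ.<⇒≤ (ℕₚ.≰⇒> ≰)))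

  commuting-remainder : ∀ x y → x ++ y ≡ y ++ x → length x ≤ length y →
                        Σ (List A) λ m → y ≡ x ++ m × x ++ m ≡ m ++ x
  commuting-remainder x y eq ≤ with ++-prefix x y y x eq ≤
  ... | m , y≡x++m , y≡m++x = m , y≡x++m , trans (sym y≡x++m) y≡m++x

  length-remainder : ∀ (a : A) x m {y} → y ≡ (a ∷ x) ++ m → length m < length y
  length-remainder a x m refl =
    subst (length m <_) (sym (Listₚ.length-++ (a ∷ x) {m})) (ℕₚ.m<n+m (length m) ℕₚ.0<1+n)

  -- Lyndon–Schützenberger: the shorter word is a prefix of the longer one, and the
  -- remainder commutes with it.
  ++-comm⇒powers : ∀ x y → x ++ y ≡ y ++ x → ∃ λ t → Σ ℕ λ i → Σ ℕ λ j → x ≡ t ^ i × y ≡ t ^ j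
  ++-comm⇒powers x y eq = go x y eq (<-wellFounded (length x ℕ.+ length y))
    where
    go : ∀ x y → x ++ y ≡ y ++ x → Acc _<_ (length x ℕ.+ length y) →
         ∃ λ t → Σ ℕ λ i → Σ ℕ λ j → x ≡ t ^ i × y ≡ t ^ j
    go []      y _ _ = y , 0 , 1 , refl , sym (^-one y)
    go (a ∷ x) [] _ _ = a ∷ x , 1 , 0 , sym (^-one (a ∷ x)) , refl
    go (a ∷ x) (b ∷ y) eq (acc rs) with length (a ∷ x) ≤? length (b ∷ y)
    ... | yes ≤ =
      let (m , y≡x++m , comm) = commuting-remainder (a ∷ x) (b ∷ y) eq ≤
          (t , i , j , x≡tⁱ , m≡tʲ) = go (a ∷ x) m comm
            (rs (ℕₚ.+-monoʳ-< (length (a ∷ x)) (length-remainder a x m y≡x++m)))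
      in t , i , i ℕ.+ j , x≡tⁱ , trans y≡x++m (trans (cong₂ _++_ x≡tⁱ m≡tʲ) (^-+ i j t))
    ... | no ≰ =
      let (m , x≡y++m , comm) = commuting-remainder (b ∷ y) (a ∷ x) (sym eq) (ℕₚ.<⇒≤ (ℕₚ.≰⇒> ≰))
          (t , i , j , y≡tⁱ , m≡tʲ) = go (b ∷ y) m comm
            (rs (subst (length (b ∷ y) ℕ.+ length m <_) (ℕₚ.+-comm (length (b ∷ y)) (length (a ∷ x)))
                   (ℕₚ.+-monoʳ-< (length (b ∷ y)) (length-remainder b y m x≡y++m))))
      in t , i ℕ.+ j , i , trans x≡y++m (trans (cong₂ _++_ y≡tⁱ m≡tʲ) (^-+ i j t)) , y≡tⁱ

  ++-equal-length : ∀ (a b c d : List A) → a ++ b ≡ c ++ d → length a ≡ length c → a ≡ c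
  ++-equal-length []      b []      d _  _   = refl
  ++-equal-length []      b (_ ∷ _) d _  ()
  ++-equal-length (_ ∷ _) b []      d _  ()
  ++-equal-length (x ∷ a) b (y ∷ c) d eq ∣a∣≡∣c∣ =
    cong₂ _∷_ (Listₚ.∷-injectiveˡ eq) (++-equal-length a b c d (Listₚ.∷-injectiveʳ eq) (ℕₚ.suc-injective ∣a∣≡∣c∣))

  ++-comm-of-square : ∀ (y q Y : List A) → y ++ Y ≡ Y ++ y → (y ++ q) ++ (y ++ q) ≡ y ++ Y →
                      y ++ q ≡ q ++ y
  ++-comm-of-square y q Y yY≡Yy eq = ++-equal-length (y ++ q) (y ++ q) (q ++ y) (q ++ y) (begin
    (y ++ q) ++ (y ++ q)   ≡⟨ eq ⟩
    y ++ Y                 ≡⟨ yY≡Yy ⟩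
    Y ++ y                 ≡⟨ cong (_++ y) qyq≡Y ⟨
    (q ++ (y ++ q)) ++ y   ≡⟨ cong (_++ y) (Listₚ.++-assoc q y q) ⟨
    ((q ++ y) ++ q) ++ y   ≡⟨ Listₚ.++-assoc (q ++ y) q y ⟩
    (q ++ y) ++ (q ++ y)   ∎) (Listₚ.length-++-comm y q)
    where
    open ≡-Reasoning
    qyq≡Y : q ++ (y ++ q) ≡ Y
    qyq≡Y = Listₚ.++-cancelˡ y (q ++ (y ++ q)) Y (trans (sym (Listₚ.++-assoc y q (y ++ q))) eq)

-- Positive words in L and R

-- The letters R and L are the signs pl and mi of Ψ's normal form S U^ε₁ ⋯ S U^εₖ,
-- so that sumSgn w counts the Rs minus the Ls of a word w.
Letter : Set
Letter = Sgn

pattern R = pl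
pattern L = mi

letter : Letter → M2
letter L = mat 1ℤ 0ℤ 1ℤ 1ℤ
letter R = mat 1ℤ 1ℤ 0ℤ 1ℤ

⟦_⟧ : List Letter → M2
⟦ [] ⟧    = I
⟦ x ∷ w ⟧ = letter x · ⟦ w ⟧

⟦⟧-++ : ∀ u v → ⟦ u ++ v ⟧ ≡ ⟦ u ⟧ · ⟦ v ⟧
⟦⟧-++ []      v = sym (·-identityˡ ⟦ v ⟧)
⟦⟧-++ (x ∷ u) v = trans (cong (letter x ·_) (⟦⟧-++ u v)) (sym (·-assoc (letter x) ⟦ u ⟧ ⟦ v ⟧))

det-⟦⟧ : ∀ w → det ⟦ w ⟧ ≡ 1ℤ
det-⟦⟧ []      = refl
det-⟦⟧ (L ∷ w) = det-·-unimodular {letter L} {⟦ w ⟧} refl (det-⟦⟧ w)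
det-⟦⟧ (R ∷ w) = det-·-unimodular {letter R} {⟦ w ⟧} refl (det-⟦⟧ w)

sumSgn-++ : ∀ u v → sumSgn (u ++ v) ≡ sumSgn u + sumSgn v
sumSgn-++ []      v = sym (ℤₚ.+-identityˡ (sumSgn v))
sumSgn-++ (x ∷ u) v =
  trans (cong (λ z → sgnℤ x + z) (sumSgn-++ u v)) (sym (ℤₚ.+-assoc (sgnℤ x) (sumSgn u) (sumSgn v)))

record ℕMat : Set where
  constructor nmat
  field p q r s : ℕ

toℤ : ℕMat → M2
toℤ (nmat p q r s) = mat (+ p) (+ q) (+ r) (+ s)

toℤ-injective : ∀ {N N′} → toℤ N ≡ toℤ N′ → N ≡ N′
toℤ-injective {nmat p q r s} {nmat p′ q′ r′ s′} refl = refl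

Unimodular : ℕMat → Set
Unimodular (nmat p q r s) = p ℕ.* s ≡ suc (q ℕ.* r)

unimodular : ∀ N → det (toℤ N) ≡ 1ℤ → Unimodular N
unimodular (nmat p q r s) det≡1 = ℤₚ.+-injective (begin
  + (p ℕ.* s)                             ≡⟨ move (+ (p ℕ.* s)) (+ (q ℕ.* r)) ⟩
  (+ (p ℕ.* s) - + (q ℕ.* r)) + + (q ℕ.* r) ≡⟨ cong (_+ + (q ℕ.* r)) det≡1′ ⟩
  1ℤ + + (q ℕ.* r)                        ∎)
  where
  open ≡-Reasoning
  move : ∀ x y → x ≡ (x - y) + y
  move = solve-∀
  det≡1′ : + (p ℕ.* s) - + (q ℕ.* r) ≡ 1ℤ
  det≡1′ = trans (cong₂ _-_ (ℤₚ.pos-* p s) (ℤₚ.pos-* q r)) det≡1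

letterℕ : Letter → ℕMat → ℕMat
letterℕ L (nmat p q r s) = nmat p q (p ℕ.+ r) (q ℕ.+ s)
letterℕ R (nmat p q r s) = nmat (r ℕ.+ p) (s ℕ.+ q) r s

⟦_⟧ℕ : List Letter → ℕMat
⟦ [] ⟧ℕ    = nmat 1 0 0 1
⟦ x ∷ w ⟧ℕ = letterℕ x ⟦ w ⟧ℕ

toℤ-letterℕ : ∀ x N → toℤ (letterℕ x N) ≡ letter x · toℤ N
toℤ-letterℕ L (nmat p q r s) =
  mat-cong (top (+ p) (+ r)) (top (+ q) (+ s))
           (trans (ℤₚ.pos-+ p r) (sum (+ p) (+ r))) (trans (ℤₚ.pos-+ q s) (sum (+ q) (+ s)))
  where
  top : ∀ x y → x ≡ 1ℤ * x + 0ℤ * y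
  top = solve-∀
  sum : ∀ x y → x + y ≡ 1ℤ * x + 1ℤ * y
  sum = solve-∀
toℤ-letterℕ R (nmat p q r s) =
  mat-cong (trans (ℤₚ.pos-+ r p) (sum (+ p) (+ r))) (trans (ℤₚ.pos-+ s q) (sum (+ q) (+ s)))
           (bottom (+ p) (+ r)) (bottom (+ q) (+ s))
  where
  sum : ∀ x y → y + x ≡ 1ℤ * x + 1ℤ * y
  sum = solve-∀
  bottom : ∀ x y → y ≡ 0ℤ * x + 1ℤ * y
  bottom = solve-∀

toℤ-⟦⟧ℕ : ∀ w → toℤ ⟦ w ⟧ℕ ≡ ⟦ w ⟧
toℤ-⟦⟧ℕ []      = refl
toℤ-⟦⟧ℕ (x ∷ w) = trans (toℤ-letterℕ x ⟦ w ⟧ℕ) (cong (letter x ·_) (toℤ-⟦⟧ℕ w))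

unimodular-⟦⟧ℕ : ∀ w → Unimodular ⟦ w ⟧ℕ
unimodular-⟦⟧ℕ w = unimodular ⟦ w ⟧ℕ (trans (cong det (toℤ-⟦⟧ℕ w)) (det-⟦⟧ w))

size : ℕMat → ℕ
size (nmat p q r s) = p ℕ.+ q ℕ.+ r ℕ.+ s

data Peeled (N : ℕMat) : Set where
  unit   : N ≡ nmat 1 0 0 1 → Peeled N
  peeled : ∀ x N′ → N ≡ letterℕ x N′ → Unimodular N′ → size N′ < size N → Peeled N

unimodular-dominant-diagonal : ∀ {p q r s} → r < p → q < s → p ℕ.* s ≡ suc (q ℕ.* r) →
                               nmat p q r s ≡ nmat 1 0 0 1
unimodular-dominant-diagonal {p} {q} {r} {s} r<p q<s ps≡1+qr =
  trans (cong₂ (λ u v → nmat p u v s) q≡0 r≡0)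
        (cong₂ (λ u v → nmat u 0 0 v) (ℕₚ.m*n≡1⇒m≡1 p s ps≡1) (ℕₚ.m*n≡1⇒n≡1 p s ps≡1))
  where
  expand : ∀ q r → suc r ℕ.* suc q ≡ suc (q ℕ.* r) ℕ.+ (q ℕ.+ r)
  expand = ℕ-Solver.solve-∀
  q+r≡0 : q ℕ.+ r ≡ 0
  q+r≡0 = ℕₚ.n≤0⇒n≡0 (ℕₚ.+-cancelˡ-≤ (suc (q ℕ.* r)) _ _
    (subst₂ ℕ._≤_ (expand q r) (trans ps≡1+qr (sym (ℕₚ.+-identityʳ _))) (ℕₚ.*-mono-≤ r<p q<s)))
  q≡0 : q ≡ 0
  q≡0 = ℕₚ.m+n≡0⇒m≡0 q q+r≡0
  r≡0 : r ≡ 0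
  r≡0 = ℕₚ.m+n≡0⇒n≡0 q q+r≡0
  ps≡1 : p ℕ.* s ≡ 1
  ps≡1 = trans ps≡1+qr (cong (λ u → suc (u ℕ.* r)) q≡0)

unimodular-dominant-antidiagonal : ∀ {p q r s} → p < r → s < q → p ℕ.* s ≢ suc (q ℕ.* r)
unimodular-dominant-antidiagonal {p} {q} {r} {s} p<r s<q ps≡1+qr = ℕₚ.<-irrefl refl (begin-strict
  q ℕ.* r           <⟨ ℕₚ.n<1+n _ ⟩
  suc (q ℕ.* r)     ≡⟨ ps≡1+qr ⟨
  p ℕ.* s           <⟨ ℕₚ.*-mono-< (ℕₚ.n<1+n p) (ℕₚ.n<1+n s) ⟩
  suc p ℕ.* suc s   ≤⟨ ℕₚ.*-mono-≤ p<r s<q ⟩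
  r ℕ.* q           ≡⟨ ℕₚ.*-comm r q ⟩
  q ℕ.* r           ∎)
  where open ℕₚ.≤-Reasoning

peel-R : ∀ k l r s → Unimodular (nmat (r ℕ.+ k) (s ℕ.+ l) r s) → Peeled (nmat (r ℕ.+ k) (s ℕ.+ l) r s)
peel-R k l r zero u = ⊥-elim (ℕₚ.0≢1+n (trans (sym (ℕₚ.*-zeroʳ (r ℕ.+ k))) u))
peel-R k l r (suc s) u = peeled R (nmat k l r (suc s)) refl unimodular′ smaller
  where
  unimodular′ : k ℕ.* suc s ≡ suc (l ℕ.* r)
  unimodular′ = ℕₚ.+-cancelˡ-≡ (r ℕ.* suc s) _ _ (trans (trans (e₁ k r (suc s)) u) (e₂ l r (suc s)))
    where
    e₁ : ∀ k r s → r ℕ.* s ℕ.+ k ℕ.* s ≡ (r ℕ.+ k) ℕ.* s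
    e₁ = ℕ-Solver.solve-∀
    e₂ : ∀ l r s → suc ((s ℕ.+ l) ℕ.* r) ≡ r ℕ.* s ℕ.+ suc (l ℕ.* r)
    e₂ = ℕ-Solver.solve-∀
  smaller : k ℕ.+ l ℕ.+ r ℕ.+ suc s < r ℕ.+ k ℕ.+ (suc s ℕ.+ l) ℕ.+ r ℕ.+ suc s
  smaller = subst (k ℕ.+ l ℕ.+ r ℕ.+ suc s <_) (regroup k l r s)
    (ℕₚ.m<n+m (k ℕ.+ l ℕ.+ r ℕ.+ suc s) {r ℕ.+ suc s} (ℕₚ.<-≤-trans ℕₚ.0<1+n (ℕₚ.m≤n+m (suc s) r)))
    where
    regroup : ∀ k l r s → r ℕ.+ suc s ℕ.+ (k ℕ.+ l ℕ.+ r ℕ.+ suc s) ≡ r ℕ.+ k ℕ.+ (suc s ℕ.+ l) ℕ.+ r ℕ.+ suc s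
    regroup = ℕ-Solver.solve-∀

peel-L : ∀ p q k l → Unimodular (nmat p q (p ℕ.+ k) (q ℕ.+ l)) → Peeled (nmat p q (p ℕ.+ k) (q ℕ.+ l))
peel-L zero q k l ()
peel-L (suc p) q k l u = peeled L (nmat (suc p) q k l) refl unimodular′ smaller
  where
  unimodular′ : suc p ℕ.* l ≡ suc (q ℕ.* k)
  unimodular′ = ℕₚ.+-cancelˡ-≡ (suc p ℕ.* q) _ _ (trans (trans (e₁ (suc p) q l) u) (e₂ (suc p) q k))
    where
    e₁ : ∀ p q l → p ℕ.* q ℕ.+ p ℕ.* l ≡ p ℕ.* (q ℕ.+ l)
    e₁ = ℕ-Solver.solve-∀
    e₂ : ∀ p q k → suc (q ℕ.* (p ℕ.+ k)) ≡ p ℕ.* q ℕ.+ suc (q ℕ.* k)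
    e₂ = ℕ-Solver.solve-∀
  smaller : suc p ℕ.+ q ℕ.+ k ℕ.+ l < suc p ℕ.+ q ℕ.+ (suc p ℕ.+ k) ℕ.+ (q ℕ.+ l)
  smaller = subst (suc p ℕ.+ q ℕ.+ k ℕ.+ l <_) (regroup p q k l)
    (ℕₚ.m<n+m (suc p ℕ.+ q ℕ.+ k ℕ.+ l) {suc p ℕ.+ q} ℕₚ.0<1+n)
    where
    regroup : ∀ p q k l → suc p ℕ.+ q ℕ.+ (suc p ℕ.+ q ℕ.+ k ℕ.+ l) ≡ suc p ℕ.+ q ℕ.+ (suc p ℕ.+ k) ℕ.+ (q ℕ.+ l)
    regroup = ℕ-Solver.solve-∀

-- One row of a nonnegative unimodular matrix dominates the other, unless it is the identity.
peel : ∀ N → Unimodular N → Peeled N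
peel (nmat p q r s) u with r ≤? p | s ≤? q
... | yes r≤p | yes s≤q with ℕₚ.m≤n⇒∃[o]m+o≡n r≤p | ℕₚ.m≤n⇒∃[o]m+o≡n s≤q
...   | k , refl | l , refl = peel-R k l r s u
peel (nmat p q r s) u | no r≰p | _ with q ≤? s
... | no q≰s = ⊥-elim (unimodular-dominant-antidiagonal (ℕₚ.≰⇒> r≰p) (ℕₚ.≰⇒> q≰s) u)
... | yes q≤s with ℕₚ.m≤n⇒∃[o]m+o≡n (ℕₚ.<⇒≤ (ℕₚ.≰⇒> r≰p)) | ℕₚ.m≤n⇒∃[o]m+o≡n q≤s
...   | k , refl | l , refl = peel-L p q k l u
peel (nmat p q r s) u | yes r≤p | no s≰q with p ≤? r
... | no p≰r = unit (unimodular-dominant-diagonal (ℕₚ.≰⇒> p≰r) (ℕₚ.≰⇒> s≰q) u)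
... | yes p≤r with ℕₚ.m≤n⇒∃[o]m+o≡n p≤r | ℕₚ.m≤n⇒∃[o]m+o≡n (ℕₚ.<⇒≤ (ℕₚ.≰⇒> s≰q))
...   | k , refl | l , refl = peel-L p q k l u

unimodular⇒⟦⟧ℕ : ∀ N → Unimodular N → ∃ λ w → ⟦ w ⟧ℕ ≡ N
unimodular⇒⟦⟧ℕ N u = go N u (<-wellFounded (size N))
  where
  go : ∀ N → Unimodular N → Acc _<_ (size N) → ∃ λ w → ⟦ w ⟧ℕ ≡ N
  go N u (acc rs) with peel N u
  ... | unit refl = [] , refl
  ... | peeled x N′ refl u′ smaller with go N′ u′ (rs smaller)
  ...   | w , refl = x ∷ w , refl

letterℕ-L≢R : ∀ N N′ → Unimodular N → letterℕ L N ≢ letterℕ R N′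
letterℕ-L≢R (nmat p q r s) (nmat p′ q′ r′ s′) u eq =
  ℕₚ.0≢1+n (trans (sym (ℕₚ.*-zeroʳ p)) (subst (λ t → p ℕ.* t ≡ _) s≡0 u))
  where
  q′+s≡0 : q′ ℕ.+ s ≡ 0
  q′+s≡0 = ℕₚ.+-cancelˡ-≡ s′ _ _ (begin
    s′ ℕ.+ (q′ ℕ.+ s)   ≡⟨ sym (ℕₚ.+-assoc s′ q′ s) ⟩
    s′ ℕ.+ q′ ℕ.+ s     ≡⟨ cong (ℕ._+ s) (sym (cong ℕMat.q eq)) ⟩
    q ℕ.+ s             ≡⟨ cong ℕMat.s eq ⟩
    s′                  ≡⟨ sym (ℕₚ.+-identityʳ s′) ⟩
    s′ ℕ.+ 0            ∎)
    where open ≡-Reasoning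
  s≡0 : s ≡ 0
  s≡0 = ℕₚ.m+n≡0⇒n≡0 q′ q′+s≡0

letterℕ-injective : ∀ x {N N′} → letterℕ x N ≡ letterℕ x N′ → N ≡ N′
letterℕ-injective L {nmat p q r s} {nmat p′ q′ r′ s′} eq with cong ℕMat.p eq | cong ℕMat.q eq
... | refl | refl =
  cong₂ (nmat p q) (ℕₚ.+-cancelˡ-≡ p r r′ (cong ℕMat.r eq)) (ℕₚ.+-cancelˡ-≡ q s s′ (cong ℕMat.s eq))
letterℕ-injective R {nmat p q r s} {nmat p′ q′ r′ s′} eq with cong ℕMat.r eq | cong ℕMat.s eq
... | refl | refl =
  cong₂ (λ u v → nmat u v r s) (ℕₚ.+-cancelˡ-≡ r p p′ (cong ℕMat.p eq)) (ℕₚ.+-cancelˡ-≡ s q q′ (cong ℕMat.q eq))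

⟦⟧ℕ-nonempty≢identity : ∀ x w → ⟦ x ∷ w ⟧ℕ ≢ nmat 1 0 0 1
⟦⟧ℕ-nonempty≢identity L w eq = ℕₚ.1+n≢0 (trans (cong (ℕ._+ ℕMat.r ⟦ w ⟧ℕ) (sym (cong ℕMat.p eq))) (cong ℕMat.r eq))
⟦⟧ℕ-nonempty≢identity R w eq = ℕₚ.1+n≢0 (trans (cong (ℕ._+ ℕMat.q ⟦ w ⟧ℕ) (sym (cong ℕMat.s eq))) (cong ℕMat.q eq))

⟦⟧ℕ-injective : ∀ u v → ⟦ u ⟧ℕ ≡ ⟦ v ⟧ℕ → u ≡ v
⟦⟧ℕ-injective []      []      _  = refl
⟦⟧ℕ-injective []      (y ∷ v) eq = ⊥-elim (⟦⟧ℕ-nonempty≢identity y v (sym eq))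
⟦⟧ℕ-injective (x ∷ u) []      eq = ⊥-elim (⟦⟧ℕ-nonempty≢identity x u eq)
⟦⟧ℕ-injective (L ∷ u) (L ∷ v) eq = cong (L ∷_) (⟦⟧ℕ-injective u v (letterℕ-injective L eq))
⟦⟧ℕ-injective (R ∷ u) (R ∷ v) eq = cong (R ∷_) (⟦⟧ℕ-injective u v (letterℕ-injective R eq))
⟦⟧ℕ-injective (L ∷ u) (R ∷ v) eq = ⊥-elim (letterℕ-L≢R ⟦ u ⟧ℕ ⟦ v ⟧ℕ (unimodular-⟦⟧ℕ u) eq)
⟦⟧ℕ-injective (R ∷ u) (L ∷ v) eq = ⊥-elim (letterℕ-L≢R ⟦ v ⟧ℕ ⟦ u ⟧ℕ (unimodular-⟦⟧ℕ v) (sym eq))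

⟦⟧-injective : ∀ u v → ⟦ u ⟧ ≡ ⟦ v ⟧ → u ≡ v
⟦⟧-injective u v eq = ⟦⟧ℕ-injective u v (toℤ-injective (trans (toℤ-⟦⟧ℕ u) (trans eq (sym (toℤ-⟦⟧ℕ v)))))

Vec₂ : Set
Vec₂ = ℤ × ℤ

NonNeg₂ NonPos₂ : Vec₂ → Set
NonNeg₂ (x , y) = (0ℤ ℤ.≤ x) × (0ℤ ℤ.≤ y)
NonPos₂ (x , y) = (x ℤ.≤ 0ℤ) × (y ℤ.≤ 0ℤ)

row₁ row₂ : M2 → Vec₂
row₁ (mat a b c d) = a , b
row₂ (mat a b c d) = c , d

NonNegMat : M2 → Set
NonNegMat X = NonNeg₂ (row₁ X) × NonNeg₂ (row₂ X)

nonneg-unimodular⇒⟦⟧ : ∀ X → det X ≡ 1ℤ → NonNegMat X → ∃ λ w → ⟦ w ⟧ ≡ X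
nonneg-unimodular⇒⟦⟧ (mat a b c d) det≡1 ((0≤a , 0≤b) , (0≤c , 0≤d)) =
  w , trans (sym (toℤ-⟦⟧ℕ w)) (trans (cong toℤ ⟦w⟧≡N) toℤN≡X)
  where
  N : ℕMat
  N = nmat (∣ a ∣) (∣ b ∣) (∣ c ∣) (∣ d ∣)
  toℤN≡X : toℤ N ≡ mat a b c d
  toℤN≡X = mat-cong (ℤₚ.0≤i⇒+∣i∣≡i 0≤a) (ℤₚ.0≤i⇒+∣i∣≡i 0≤b) (ℤₚ.0≤i⇒+∣i∣≡i 0≤c) (ℤₚ.0≤i⇒+∣i∣≡i 0≤d)
  decomposition : ∃ λ w → ⟦ w ⟧ℕ ≡ N
  decomposition = unimodular⇒⟦⟧ℕ N (unimodular N (trans (cong det toℤN≡X) det≡1))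
  w = proj₁ decomposition
  ⟦w⟧≡N = proj₂ decomposition

-- Rows of X · ⟦ t ⟧ for long words t

_◃_ : Vec₂ → Letter → Vec₂
(x , y) ◃ L = x + y , y
(x , y) ◃ R = x , x + y

_◃*_ : Vec₂ → List Letter → Vec₂
v ◃* []      = v
v ◃* (l ∷ t) = (v ◃ l) ◃* t

OneSigned : Vec₂ → Set
OneSigned v = NonNeg₂ v ⊎ NonPos₂ v

NonNeg₂-◃* : ∀ t {v} → NonNeg₂ v → NonNeg₂ (v ◃* t)
NonNeg₂-◃* []      nn = nn
NonNeg₂-◃* (L ∷ t) (0≤x , 0≤y) = NonNeg₂-◃* t (ℤₚ.+-mono-≤ 0≤x 0≤y , 0≤y)
NonNeg₂-◃* (R ∷ t) (0≤x , 0≤y) = NonNeg₂-◃* t (0≤x , ℤₚ.+-mono-≤ 0≤x 0≤y)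

NonPos₂-◃* : ∀ t {v} → NonPos₂ v → NonPos₂ (v ◃* t)
NonPos₂-◃* []      np = np
NonPos₂-◃* (L ∷ t) (x≤0 , y≤0) = NonPos₂-◃* t (ℤₚ.+-mono-≤ x≤0 y≤0 , y≤0)
NonPos₂-◃* (R ∷ t) (x≤0 , y≤0) = NonPos₂-◃* t (x≤0 , ℤₚ.+-mono-≤ x≤0 y≤0)

OneSigned-◃* : ∀ t {v} → OneSigned v → OneSigned (v ◃* t)
OneSigned-◃* t (inj₁ nn) = inj₁ (NonNeg₂-◃* t nn)
OneSigned-◃* t (inj₂ np) = inj₂ (NonPos₂-◃* t np)

neg₂ : Vec₂ → Vec₂
neg₂ (x , y) = - x , - y

◃*-neg₂ : ∀ t v → neg₂ v ◃* t ≡ neg₂ (v ◃* t)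
◃*-neg₂ []      v       = refl
◃*-neg₂ (L ∷ t) (x , y) = trans (cong (λ z → (z , - y) ◃* t) (sym (ℤₚ.neg-distrib-+ x y))) (◃*-neg₂ t (x + y , y))
◃*-neg₂ (R ∷ t) (x , y) = trans (cong (λ z → (- x , z) ◃* t) (sym (ℤₚ.neg-distrib-+ x y))) (◃*-neg₂ t (x , x + y))

NonNeg₂-neg₂ : ∀ {v} → NonPos₂ v → NonNeg₂ (neg₂ v)
NonNeg₂-neg₂ (x≤0 , y≤0) = ℤₚ.neg-mono-≤ x≤0 , ℤₚ.neg-mono-≤ y≤0

NonPos₂-neg₂ : ∀ {v} → NonNeg₂ v → NonPos₂ (neg₂ v)
NonPos₂-neg₂ (0≤x , 0≤y) = ℤₚ.neg-mono-≤ 0≤x , ℤₚ.neg-mono-≤ 0≤y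

OneSigned-neg₂ : ∀ {v} → OneSigned v → OneSigned (neg₂ v)
OneSigned-neg₂ (inj₁ nn) = inj₂ (NonPos₂-neg₂ nn)
OneSigned-neg₂ (inj₂ np) = inj₁ (NonNeg₂-neg₂ np)

0≤+ : ∀ n → 0ℤ ℤ.≤ + n
0≤+ n = +≤+ ℕ.z≤n

-+≤0 : ∀ n → - (+ n) ℤ.≤ 0ℤ
-+≤0 n = ℤₚ.neg-mono-≤ (0≤+ n)

-- Each letter moves the vector (P, -N) to one with smaller |P| + |N|, until it becomes one-signed.
oneSigned-◃*-mixed : ∀ t P N → P ℕ.+ N ≤ length t → OneSigned ((+ P , - (+ N)) ◃* t)
oneSigned-◃*-mixed t P       zero    _ = OneSigned-◃* t (inj₁ (0≤+ P , ℤₚ.≤-refl))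
oneSigned-◃*-mixed t zero    (suc N) _ = OneSigned-◃* t (inj₂ (ℤₚ.≤-refl , -+≤0 (suc N)))
oneSigned-◃*-mixed (L ∷ t) (suc P) (suc N) (s≤s bound) with suc N ≤? suc P
... | yes N≤P = subst (λ z → OneSigned ((z , - (+ suc N)) ◃* t))
                      (sym (trans (ℤₚ.m-n≡m⊖n (suc P) (suc N)) (ℤₚ.⊖-≥ N≤P)))
                      (oneSigned-◃*-mixed t (suc P ℕ.∸ suc N) (suc N) bound′)
  where
  bound′ : (suc P ℕ.∸ suc N) ℕ.+ suc N ≤ length t
  bound′ = ℕₚ.≤-trans (ℕₚ.≤-reflexive (ℕₚ.m∸n+n≡m N≤P))
             (ℕₚ.≤-trans (s≤s (ℕₚ.m≤m+n P N)) (subst (_≤ length t) (ℕₚ.+-suc P N) bound))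
... | no N≰P = subst (λ z → OneSigned ((z , - (+ suc N)) ◃* t))
                     (sym (trans (ℤₚ.m-n≡m⊖n (suc P) (suc N)) (ℤₚ.⊖-< (ℕₚ.≰⇒> N≰P))))
                     (OneSigned-◃* t (inj₂ (-+≤0 _ , -+≤0 _)))
oneSigned-◃*-mixed (R ∷ t) (suc P) (suc N) (s≤s bound) with suc N ≤? suc P
... | yes N≤P = subst (λ z → OneSigned ((+ suc P , z) ◃* t))
                      (sym (trans (ℤₚ.m-n≡m⊖n (suc P) (suc N)) (ℤₚ.⊖-≥ N≤P)))
                      (OneSigned-◃* t (inj₁ (0≤+ _ , 0≤+ _)))
... | no N≰P = subst (λ z → OneSigned ((+ suc P , z) ◃* t))
                     (sym (trans (ℤₚ.m-n≡m⊖n (suc P) (suc N)) (ℤₚ.⊖-< (ℕₚ.≰⇒> N≰P))))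
                     (oneSigned-◃*-mixed t (suc P) (suc N ℕ.∸ suc P) bound′)
  where
  bound′ : suc P ℕ.+ (suc N ℕ.∸ suc P) ≤ length t
  bound′ = ℕₚ.≤-trans (ℕₚ.≤-reflexive (ℕₚ.m+[n∸m]≡n (ℕₚ.<⇒≤ (ℕₚ.≰⇒> N≰P))))
             (ℕₚ.≤-trans (s≤s (ℕₚ.m≤n+m N P)) (subst (_≤ length t) (ℕₚ.+-suc P N) bound))

∥_∥₂ : Vec₂ → ℕ
∥ x , y ∥₂ = ∣ x ∣ ℕ.+ ∣ y ∣

oneSigned-◃* : ∀ t v → ∥ v ∥₂ ≤ length t → OneSigned (v ◃* t)
oneSigned-◃* t (+ a      , + b)      _     = OneSigned-◃* t (inj₁ (0≤+ a , 0≤+ b))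
oneSigned-◃* t (-[1+ a ] , -[1+ b ]) _     = OneSigned-◃* t (inj₂ (-+≤0 (suc a) , -+≤0 (suc b)))
oneSigned-◃* t (+ a      , -[1+ b ]) bound = oneSigned-◃*-mixed t a (suc b) bound
oneSigned-◃* t (-[1+ a ] , + b)      bound =
  subst OneSigned flip (OneSigned-neg₂ (oneSigned-◃*-mixed t (suc a) b bound))
  where
  flip : neg₂ ((+ suc a , - (+ b)) ◃* t) ≡ (-[1+ a ] , + b) ◃* t
  flip = trans (sym (◃*-neg₂ t (+ suc a , - (+ b)))) (cong (λ z → (-[1+ a ] , z) ◃* t) (ℤₚ.neg-involutive (+ b)))

row₁-·-letter : ∀ X l → row₁ (X · letter l) ≡ row₁ X ◃ l
row₁-·-letter (mat a b c d) L = cong₂ _,_ (sum a b) (second a b)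
  where
  sum : ∀ x y → x * 1ℤ + y * 1ℤ ≡ x + y
  sum = solve-∀
  second : ∀ x y → x * 0ℤ + y * 1ℤ ≡ y
  second = solve-∀
row₁-·-letter (mat a b c d) R = cong₂ _,_ (first a b) (sum a b)
  where
  sum : ∀ x y → x * 1ℤ + y * 1ℤ ≡ x + y
  sum = solve-∀
  first : ∀ x y → x * 1ℤ + y * 0ℤ ≡ x
  first = solve-∀

row₁-·⟦⟧ : ∀ X t → row₁ (X · ⟦ t ⟧) ≡ row₁ X ◃* t
row₁-·⟦⟧ X []      = cong row₁ (·-identityʳ X)
row₁-·⟦⟧ X (l ∷ t) = begin
  row₁ (X · (letter l · ⟦ t ⟧))   ≡⟨ cong row₁ (·-assoc X (letter l) ⟦ t ⟧) ⟨
  row₁ (X · letter l · ⟦ t ⟧)     ≡⟨ row₁-·⟦⟧ (X · letter l) t ⟩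
  row₁ (X · letter l) ◃* t        ≡⟨ cong (_◃* t) (row₁-·-letter X l) ⟩
  (row₁ X ◃ l) ◃* t               ∎
  where open ≡-Reasoning

row₂-·⟦⟧ : ∀ X t → row₂ (X · ⟦ t ⟧) ≡ row₂ X ◃* t
row₂-·⟦⟧ (mat a b c d) t = row₁-·⟦⟧ (mat c d a b) t

∥_∥ : M2 → ℕ
∥ mat a b c d ∥ = (∣ a ∣ ℕ.+ ∣ b ∣) ℕ.+ (∣ c ∣ ℕ.+ ∣ d ∣)

oneSigned-rows : ∀ X t → ∥ X ∥ ≤ length t → OneSigned (row₁ (X · ⟦ t ⟧)) × OneSigned (row₂ (X · ⟦ t ⟧))
oneSigned-rows X@(mat a b c d) t bound =
  subst OneSigned (sym (row₁-·⟦⟧ X t)) (oneSigned-◃* t (a , b) (ℕₚ.≤-trans (ℕₚ.m≤m+n _ _) bound)) ,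
  subst OneSigned (sym (row₂-·⟦⟧ X t))
    (oneSigned-◃* t (c , d) (ℕₚ.≤-trans (ℕₚ.m≤n+m (∥ c , d ∥₂) (∥ a , b ∥₂)) bound))

transpose : M2 → M2
transpose (mat a b c d) = mat a c b d

transpose-· : ∀ X Y → transpose (X · Y) ≡ transpose Y · transpose X
transpose-· (mat a b c d) (mat e f g h) = mat-cong (entry a b e g) (entry c d e g) (entry a b f h) (entry c d f h)
  where
  entry : ∀ a b e g → a * e + b * g ≡ e * a + g * b
  entry = solve-∀

∥transpose∥ : ∀ X → ∥ transpose X ∥ ≡ ∥ X ∥
∥transpose∥ (mat a b c d) = swap-middle (∣ a ∣) (∣ b ∣) (∣ c ∣) (∣ d ∣)
  where
  swap-middle : ∀ a b c d → (a ℕ.+ c) ℕ.+ (b ℕ.+ d) ≡ (a ℕ.+ b) ℕ.+ (c ℕ.+ d)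
  swap-middle = ℕ-Solver.solve-∀

mirror : Letter → Letter
mirror L = R
mirror R = L

transpose-⟦⟧ : ∀ t → transpose ⟦ t ⟧ ≡ ⟦ reverse (map mirror t) ⟧
transpose-⟦⟧ []      = refl
transpose-⟦⟧ (l ∷ t) = begin
  transpose (letter l · ⟦ t ⟧)                           ≡⟨ transpose-· (letter l) ⟦ t ⟧ ⟩
  transpose ⟦ t ⟧ · transpose (letter l)                 ≡⟨ cong₂ _·_ (transpose-⟦⟧ t) (transpose-letter l) ⟩
  ⟦ reverse (map mirror t) ⟧ · ⟦ [ mirror l ] ⟧          ≡⟨ ⟦⟧-++ (reverse (map mirror t)) [ mirror l ] ⟨
  ⟦ reverse (map mirror t) ++ [ mirror l ] ⟧             ≡⟨ cong ⟦_⟧ (Listₚ.unfold-reverse (mirror l) (map mirror t)) ⟨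
  ⟦ reverse (map mirror (l ∷ t)) ⟧                       ∎
  where
  open ≡-Reasoning
  transpose-letter : ∀ l → transpose (letter l) ≡ ⟦ [ mirror l ] ⟧
  transpose-letter L = refl
  transpose-letter R = refl

oneSigned-columns : ∀ X t → ∥ X ∥ ≤ length t →
  OneSigned (row₁ (transpose (⟦ t ⟧ · X))) × OneSigned (row₂ (transpose (⟦ t ⟧ · X)))
oneSigned-columns X t bound =
  subst (λ Y → OneSigned (row₁ Y) × OneSigned (row₂ Y)) (sym transposed)
    (oneSigned-rows (transpose X) t′ (subst₂ _≤_ (sym (∥transpose∥ X)) (sym length-t′) bound))
  where
  t′ : List Letter
  t′ = reverse (map mirror t)
  length-t′ : length t′ ≡ length t
  length-t′ = trans (Listₚ.length-reverse (map mirror t)) (Listₚ.length-map mirror t)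
  transposed : transpose (⟦ t ⟧ · X) ≡ transpose X · ⟦ t′ ⟧
  transposed = trans (transpose-· ⟦ t ⟧ X) (cong (transpose X ·_) (transpose-⟦⟧ t))

-- Conjugate hyperbolic positive words have the same count

sumSgn-conj : ∀ w p q → w ++ p ≡ q ++ w → sumSgn p ≡ sumSgn q
sumSgn-conj w p q eq = begin
  sumSgn p                          ≡⟨ cancel (sumSgn w) (sumSgn p) ⟩
  sumSgn w + sumSgn p - sumSgn w    ≡⟨ cong (_- sumSgn w) (sumSgn-++ w p) ⟨
  sumSgn (w ++ p) - sumSgn w        ≡⟨ cong (λ u → sumSgn u - sumSgn w) eq ⟩
  sumSgn (q ++ w) - sumSgn w        ≡⟨ cong (_- sumSgn w) (sumSgn-++ q w) ⟩
  sumSgn q + sumSgn w - sumSgn w    ≡⟨ cancel′ (sumSgn q) (sumSgn w) ⟩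
  sumSgn q                          ∎
  where
  open ≡-Reasoning
  cancel : ∀ x y → y ≡ x + y - x
  cancel = solve-∀
  cancel′ : ∀ y x → y + x - x ≡ y
  cancel′ = solve-∀

sumSgn-conj-nonneg : ∀ h p q → det h ≡ 1ℤ → NonNegMat h → h · ⟦ p ⟧ ≡ ⟦ q ⟧ · h → sumSgn p ≡ sumSgn q
sumSgn-conj-nonneg h p q det≡1 nonneg hp≡qh with nonneg-unimodular⇒⟦⟧ h det≡1 nonneg
... | w , refl = sumSgn-conj w p q (⟦⟧-injective (w ++ p) (q ++ w) (begin
  ⟦ w ++ p ⟧        ≡⟨ ⟦⟧-++ w p ⟩
  ⟦ w ⟧ · ⟦ p ⟧     ≡⟨ hp≡qh ⟩
  ⟦ q ⟧ · ⟦ w ⟧     ≡⟨ ⟦⟧-++ q w ⟨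
  ⟦ q ++ w ⟧        ∎))
  where open ≡-Reasoning

Antidiagonal : M2 → Set
Antidiagonal X = (a X ≡ 0ℤ) × (d X ≡ 0ℤ) × (b X ≢ 0ℤ) × (c X ≢ 0ℤ)

oneSigned-zero : ∀ {x y} → 0ℤ ℤ.≤ x → y ℤ.≤ 0ℤ → OneSigned (x , y) → x ≡ 0ℤ ⊎ y ≡ 0ℤ
oneSigned-zero 0≤x y≤0 (inj₁ (_ , 0≤y)) = inj₂ (ℤₚ.≤-antisym y≤0 0≤y)
oneSigned-zero 0≤x y≤0 (inj₂ (x≤0 , _)) = inj₁ (ℤₚ.≤-antisym x≤0 0≤x)

-- With nonnegative first and nonpositive second row, one-signed columns force
-- a zero in each column; det = 1 then leaves only the antidiagonal.
antidiagonal : ∀ X → det X ≡ 1ℤ → NonNeg₂ (row₁ X) → NonPos₂ (row₂ X) →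
               OneSigned (row₁ (transpose X)) → OneSigned (row₂ (transpose X)) → Antidiagonal X
antidiagonal (mat a b c d) det≡1 (0≤a , 0≤b) (c≤0 , d≤0) col₁ col₂ = a≡0 , d≡0 , b≢0 , c≢0
  where
  c≢0 : c ≢ 0ℤ
  c≢0 refl = det≢1 a b 0ℤ d (nonneg*nonpos≤0 0≤a d≤0) (ℤₚ.≤-reflexive (sym (ℤₚ.*-zeroʳ b))) det≡1
  b≢0 : b ≢ 0ℤ
  b≢0 refl = det≢1 a 0ℤ c d (nonneg*nonpos≤0 0≤a d≤0) ℤₚ.≤-refl det≡1
  a≡0 : a ≡ 0ℤ
  a≡0 = [ id , ⊥-elim ∘ c≢0 ]′ (oneSigned-zero 0≤a c≤0 col₁)
  d≡0 : d ≡ 0ℤ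
  d≡0 = [ ⊥-elim ∘ b≢0 , id ]′ (oneSigned-zero 0≤b d≤0 col₂)

antidiagonal-·⇒diagonal : ∀ Q X → Antidiagonal X → Antidiagonal (Q · X) → (b Q ≡ 0ℤ) × (c Q ≡ 0ℤ)
antidiagonal-·⇒diagonal (mat a b c d) (mat e f g h) (refl , refl , f≢0 , g≢0) (QXa≡0 , QXd≡0 , _) =
  factor b g (trans (sym (only-b a b g)) QXa≡0) g≢0 ,
  factor c f (trans (sym (only-c c d f)) QXd≡0) f≢0
  where
  only-b : ∀ a b g → a * 0ℤ + b * g ≡ b * g
  only-b = solve-∀
  only-c : ∀ c d f → c * f + d * 0ℤ ≡ c * f
  only-c = solve-∀
  factor : ∀ x y → x * y ≡ 0ℤ → y ≢ 0ℤ → x ≡ 0ℤ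
  factor x y xy≡0 y≢0 with ℤₚ.i*j≡0⇒i≡0∨j≡0 x xy≡0
  ... | inj₁ x≡0 = x≡0
  ... | inj₂ y≡0 = ⊥-elim (y≢0 y≡0)

⟦⟧-diagonal⇒[] : ∀ w → b ⟦ w ⟧ ≡ 0ℤ → c ⟦ w ⟧ ≡ 0ℤ → w ≡ []
⟦⟧-diagonal⇒[] w b≡0 c≡0 = ⟦⟧ℕ-injective w [] (begin
  ⟦ w ⟧ℕ           ≡⟨ cong₂ (λ u v → nmat p u v s) q≡0 r≡0 ⟩
  nmat p 0 0 s     ≡⟨ cong₂ (λ u v → nmat u 0 0 v) (ℕₚ.m*n≡1⇒m≡1 p s ps≡1) (ℕₚ.m*n≡1⇒n≡1 p s ps≡1) ⟩
  nmat 1 0 0 1     ∎)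
  where
  open ≡-Reasoning
  open ℕMat ⟦ w ⟧ℕ
  q≡0 : q ≡ 0
  q≡0 = ℤₚ.+-injective (trans (cong b (toℤ-⟦⟧ℕ w)) b≡0)
  r≡0 : r ≡ 0
  r≡0 = ℤₚ.+-injective (trans (cong c (toℤ-⟦⟧ℕ w)) c≡0)
  ps≡1 : p ℕ.* s ≡ 1
  ps≡1 = trans (unimodular-⟦⟧ℕ w) (cong₂ (λ u v → suc (u ℕ.* v)) q≡0 r≡0)

Intertwines : M2 → List Letter → List Letter → Set
Intertwines h p q = ∀ m → h · ⟦ p ^ m ⟧ ≡ ⟦ q ^ m ⟧ · h

-- Along the powers X k = ⟦ q ^ k ⟧ · h = h · ⟦ p ^ k ⟧ the row signs of h persist while the
-- columns become one-signed; two consecutive antidiagonal X k make ⟦ q ⟧ diagonal.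
mixed-rows-impossible : ∀ h p q → det h ≡ 1ℤ → NonNeg₂ (row₁ h) → NonPos₂ (row₂ h) →
                        Intertwines h p q → q ≢ [] → ⊥
mixed-rows-impossible h p q det≡1 row₁≥0 row₂≤0 intertwines q≢[] =
  q≢[] (⟦⟧-diagonal⇒[] q bQ≡0 cQ≡0)
  where
  X : ℕ → M2
  X k = ⟦ q ^ k ⟧ · h
  antidiagonal-X : ∀ k → ∥ h ∥ ≤ k → Antidiagonal (X k)
  antidiagonal-X k ∥h∥≤k = antidiagonal (X k)
    (trans (det-· ⟦ q ^ k ⟧ h) (cong₂ _*_ (det-⟦⟧ (q ^ k)) det≡1))
    (subst (λ Y → NonNeg₂ (row₁ Y)) (intertwines k)
      (subst NonNeg₂ (sym (row₁-·⟦⟧ h (p ^ k))) (NonNeg₂-◃* (p ^ k) row₁≥0)))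
    (subst (λ Y → NonPos₂ (row₂ Y)) (intertwines k)
      (subst NonPos₂ (sym (row₂-·⟦⟧ h (p ^ k))) (NonPos₂-◃* (p ^ k) row₂≤0)))
    (proj₁ columns) (proj₂ columns)
    where
    columns = oneSigned-columns h (q ^ k) (ℕₚ.≤-trans ∥h∥≤k (≤-length-^ k q q≢[]))
  next : X (suc ∥ h ∥) ≡ ⟦ q ⟧ · X ∥ h ∥
  next = trans (cong (_· h) (⟦⟧-++ q (q ^ ∥ h ∥))) (·-assoc ⟦ q ⟧ ⟦ q ^ ∥ h ∥ ⟧ h)
  diagonal = antidiagonal-·⇒diagonal ⟦ q ⟧ (X ∥ h ∥) (antidiagonal-X ∥ h ∥ ℕₚ.≤-refl)
               (subst Antidiagonal next (antidiagonal-X (suc ∥ h ∥) (ℕₚ.n≤1+n ∥ h ∥)))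
  bQ≡0 = proj₁ diagonal
  cQ≡0 = proj₂ diagonal

intertwine-neg : ∀ X Y Z → X · Y ≡ Z · X → neg X · Y ≡ Z · neg X
intertwine-neg X Y Z eq = begin
  neg X · Y     ≡⟨ neg-distribˡ-· X Y ⟨
  neg (X · Y)   ≡⟨ cong neg eq ⟩
  neg (Z · X)   ≡⟨ neg-distribʳ-· Z X ⟩
  Z · neg X     ∎
  where open ≡-Reasoning

intertwines-^ : ∀ h p q → h · ⟦ p ⟧ ≡ ⟦ q ⟧ · h → Intertwines h p q
intertwines-^ h p q hp≡qh zero    = trans (·-identityʳ h) (sym (·-identityˡ h))
intertwines-^ h p q hp≡qh (suc m) = begin
  h · ⟦ p ++ p ^ m ⟧            ≡⟨ cong (h ·_) (⟦⟧-++ p (p ^ m)) ⟩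
  h · (⟦ p ⟧ · ⟦ p ^ m ⟧)       ≡⟨ ·-assoc h ⟦ p ⟧ ⟦ p ^ m ⟧ ⟨
  h · ⟦ p ⟧ · ⟦ p ^ m ⟧         ≡⟨ cong (_· ⟦ p ^ m ⟧) hp≡qh ⟩
  ⟦ q ⟧ · h · ⟦ p ^ m ⟧         ≡⟨ ·-assoc ⟦ q ⟧ h ⟦ p ^ m ⟧ ⟩
  ⟦ q ⟧ · (h · ⟦ p ^ m ⟧)       ≡⟨ cong (⟦ q ⟧ ·_) (intertwines-^ h p q hp≡qh m) ⟩
  ⟦ q ⟧ · (⟦ q ^ m ⟧ · h)       ≡⟨ ·-assoc ⟦ q ⟧ ⟦ q ^ m ⟧ h ⟨
  ⟦ q ⟧ · ⟦ q ^ m ⟧ · h         ≡⟨ cong (_· h) (⟦⟧-++ q (q ^ m)) ⟨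
  ⟦ q ++ q ^ m ⟧ · h            ∎
  where open ≡-Reasoning

sumSgn-conj-oneSigned : ∀ h p q → det h ≡ 1ℤ → OneSigned (row₁ h) → OneSigned (row₂ h) →
                        h · ⟦ p ⟧ ≡ ⟦ q ⟧ · h → q ≢ [] → sumSgn p ≡ sumSgn q
sumSgn-conj-oneSigned h p q det≡1 (inj₁ row₁≥0) (inj₁ row₂≥0) hp≡qh _ =
  sumSgn-conj-nonneg h p q det≡1 (row₁≥0 , row₂≥0) hp≡qh
sumSgn-conj-oneSigned h p q det≡1 (inj₂ row₁≤0) (inj₂ row₂≤0) hp≡qh _ =
  sumSgn-conj-nonneg (neg h) p q (trans (det-neg h) det≡1) (NonNeg₂-neg₂ row₁≤0 , NonNeg₂-neg₂ row₂≤0)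
    (intertwine-neg h ⟦ p ⟧ ⟦ q ⟧ hp≡qh)
sumSgn-conj-oneSigned h p q det≡1 (inj₁ row₁≥0) (inj₂ row₂≤0) hp≡qh q≢[] =
  ⊥-elim (mixed-rows-impossible h p q det≡1 row₁≥0 row₂≤0 (intertwines-^ h p q hp≡qh) q≢[])
sumSgn-conj-oneSigned h p q det≡1 (inj₂ row₁≤0) (inj₁ row₂≥0) hp≡qh q≢[] =
  ⊥-elim (mixed-rows-impossible (neg h) p q (trans (det-neg h) det≡1)
            (NonNeg₂-neg₂ row₁≤0) (NonPos₂-neg₂ row₂≥0)
            (intertwines-^ (neg h) p q (intertwine-neg h ⟦ p ⟧ ⟦ q ⟧ hp≡qh)) q≢[])

tr-⟦⟧ : ∀ w → tr ⟦ w ⟧ ≡ + (ℕMat.p ⟦ w ⟧ℕ ℕ.+ ℕMat.s ⟦ w ⟧ℕ)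
tr-⟦⟧ w = trans (cong tr (sym (toℤ-⟦⟧ℕ w))) (sym (ℤₚ.pos-+ (ℕMat.p ⟦ w ⟧ℕ) (ℕMat.s ⟦ w ⟧ℕ)))

hyperbolic⇒nonempty : ∀ w → 2 ℕ.< ∣ tr ⟦ w ⟧ ∣ → w ≢ []
hyperbolic⇒nonempty [] 2<2 refl = ℕₚ.<-irrefl refl 2<2

-- Powers of ⟦ p ⟧ make the rows of g · ⟦ p ^ ∥ g ∥ ⟧ one-signed, and this matrix still
-- conjugates ⟦ p ⟧ to ⟦ q ⟧.
sumSgn-Conj : ∀ p q → 2 ℕ.< ∣ tr ⟦ p ⟧ ∣ → Conj ⟦ p ⟧ ⟦ q ⟧ → sumSgn p ≡ sumSgn q
sumSgn-Conj p q hyp (g , det≡1 , inj₂ gp≡-qg) = ⊥-elim (ℕₚ.n≮0 (subst (2 ℕ.<_) ∣tr⟦p⟧∣≡0 hyp))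
  where
  tr⟦p⟧≡-tr⟦q⟧ : + (ℕMat.p ⟦ p ⟧ℕ ℕ.+ ℕMat.s ⟦ p ⟧ℕ) ≡ - + (ℕMat.p ⟦ q ⟧ℕ ℕ.+ ℕMat.s ⟦ q ⟧ℕ)
  tr⟦p⟧≡-tr⟦q⟧ = begin
    + _              ≡⟨ tr-⟦⟧ p ⟨
    tr ⟦ p ⟧         ≡⟨ tr-conj {g} {⟦ p ⟧} {neg ⟦ q ⟧} det≡1 (trans gp≡-qg (neg-distribˡ-· ⟦ q ⟧ g)) ⟩
    tr (neg ⟦ q ⟧)   ≡⟨ tr-neg ⟦ q ⟧ ⟩
    - tr ⟦ q ⟧       ≡⟨ cong -_ (tr-⟦⟧ q) ⟩
    - + _            ∎
    where open ≡-Reasoning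
  +≡-+⇒0 : ∀ m n → + m ≡ - + n → m ≡ 0
  +≡-+⇒0 m zero    eq = ℤₚ.+-injective eq
  +≡-+⇒0 m (suc n) ()
  ∣tr⟦p⟧∣≡0 : ∣ tr ⟦ p ⟧ ∣ ≡ 0
  ∣tr⟦p⟧∣≡0 = trans (cong ∣_∣ (tr-⟦⟧ p)) (+≡-+⇒0 _ _ tr⟦p⟧≡-tr⟦q⟧)
sumSgn-Conj p q hyp (g , det≡1 , inj₁ gp≡qg) =
  sumSgn-conj-oneSigned h p q det-h (proj₁ rows) (proj₂ rows) hp≡qh q≢[]
  where
  n = ∥ g ∥
  h = g · ⟦ p ^ n ⟧
  det-h : det h ≡ 1ℤ
  det-h = trans (det-· g ⟦ p ^ n ⟧) (cong₂ _*_ det≡1 (det-⟦⟧ (p ^ n)))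
  rows = oneSigned-rows g (p ^ n) (≤-length-^ n p (hyperbolic⇒nonempty p hyp))
  q≢[] : q ≢ []
  q≢[] = hyperbolic⇒nonempty q (subst (2 ℕ.<_) (∣tr∣-Conj {⟦ p ⟧} {⟦ q ⟧} (g , det≡1 , inj₁ gp≡qg)) hyp)
  hp≡qh : h · ⟦ p ⟧ ≡ ⟦ q ⟧ · h
  hp≡qh = begin
    g · ⟦ p ^ n ⟧ · ⟦ p ⟧       ≡⟨ ·-assoc g ⟦ p ^ n ⟧ ⟦ p ⟧ ⟩
    g · (⟦ p ^ n ⟧ · ⟦ p ⟧)     ≡⟨ cong (g ·_) (⟦⟧-++ (p ^ n) p) ⟨
    g · ⟦ p ^ n ++ p ⟧          ≡⟨ cong (λ u → g · ⟦ u ⟧) (^-suc-comm n p) ⟨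
    g · ⟦ p ++ p ^ n ⟧          ≡⟨ intertwines-^ g p q gp≡qg (suc n) ⟩
    ⟦ q ++ q ^ n ⟧ · g          ≡⟨ cong (_· g) (⟦⟧-++ q (q ^ n)) ⟩
    ⟦ q ⟧ · ⟦ q ^ n ⟧ · g       ≡⟨ ·-assoc ⟦ q ⟧ ⟦ q ^ n ⟧ g ⟩
    ⟦ q ⟧ · (⟦ q ^ n ⟧ · g)     ≡⟨ cong (⟦ q ⟧ ·_) (intertwines-^ g p q gp≡qg n) ⟨
    ⟦ q ⟧ · h                    ∎
    where open ≡-Reasoning

-- The Rademacher function of a positive word

S⁻¹ : M2
S⁻¹ = mat 0ℤ 1ℤ (- 1ℤ) 0ℤ

conj-·-distrib : ∀ g h X Y → g · h ≡ I → (h · X · g) · (h · Y · g) ≡ h · (X · Y) · g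
conj-·-distrib g h X Y gh≡I = begin
  h · X · g · (h · Y · g)       ≡⟨ ·-assoc (h · X · g) (h · Y) g ⟨
  h · X · g · (h · Y) · g       ≡⟨ cong (_· g) (·-assoc (h · X · g) h Y) ⟨
  h · X · g · h · Y · g         ≡⟨ cong (λ Z → Z · Y · g) (·-assoc (h · X) g h) ⟩
  h · X · (g · h) · Y · g       ≡⟨ cong (λ Z → h · X · Z · Y · g) gh≡I ⟩
  h · X · I · Y · g             ≡⟨ cong (λ Z → Z · Y · g) (·-identityʳ (h · X)) ⟩
  h · X · Y · g                 ≡⟨ cong (_· g) (·-assoc h X Y) ⟩
  h · (X · Y) · g               ∎
  where open ≡-Reasoning

Conj-S : ∀ X → Conj (S⁻¹ · X · S) X
Conj-S X = S , refl , inj₁ (begin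
  S · (S⁻¹ · X · S)     ≡⟨ ·-assoc S (S⁻¹ · X) S ⟨
  S · (S⁻¹ · X) · S     ≡⟨ cong (_· S) (·-assoc S S⁻¹ X) ⟨
  S · S⁻¹ · X · S       ≡⟨⟩
  I · X · S             ≡⟨ cong (_· S) (·-identityˡ X) ⟩
  X · S                 ∎)
  where open ≡-Reasoning

word-PEq : ∀ es → PEq (word es) (S⁻¹ · ⟦ es ⟧ · S)
word-PEq []       = inj₁ refl
word-PEq (e ∷ es) = PEq-trans (·-cong (SU e) (word-PEq es)) (inj₁ (conj-·-distrib S S⁻¹ (letter e) ⟦ es ⟧ refl))
  where
  SU : ∀ e → PEq (S · Upow e) (S⁻¹ · letter e · S)
  SU R = inj₂ refl
  SU L = inj₁ refl

HasΨ-⟦⟧ : ∀ A w → w ≢ [] → Conj A ⟦ w ⟧ → HasΨ A (sumSgn w)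
HasΨ-⟦⟧ A w w≢[] A~⟦w⟧ = inj₂ (inj₂ (inj₂ (w , w≢[] , A~word , refl)))
  where
  open import Relation.Binary.Reasoning.Setoid Conj-setoid
  A~word : Conj A (word w)
  A~word = begin
    A                   ≈⟨ A~⟦w⟧ ⟩
    ⟦ w ⟧               ≈⟨ Conj-S ⟦ w ⟧ ⟨
    S⁻¹ · ⟦ w ⟧ · S     ≈⟨ PEq⇒Conj (word-PEq w) ⟨
    word w              ∎

trace-≤2 : ∀ A w → 2 ℕ.< ∣ tr ⟦ w ⟧ ∣ → Conj A ⟦ w ⟧ → ∀ B → Conj A B → ∣ tr B ∣ ℕ.≤ 2 → ⊥
trace-≤2 A w hyp A~⟦w⟧ B A~B ∣trB∣≤2 =
  ℕₚ.<⇒≱ hyp (subst (ℕ._≤ 2) (trans (sym (∣tr∣-Conj {A} {B} A~B)) (∣tr∣-Conj {A} {⟦ w ⟧} A~⟦w⟧)) ∣trB∣≤2)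

HasΨ-unique : ∀ A w k → 2 ℕ.< ∣ tr ⟦ w ⟧ ∣ → Conj A ⟦ w ⟧ → HasΨ A k → k ≡ sumSgn w
HasΨ-unique A w k hyp A~⟦w⟧ (inj₁ (A~S , _))                 = ⊥-elim (trace-≤2 A w hyp A~⟦w⟧ S A~S z≤n)
HasΨ-unique A w k hyp A~⟦w⟧ (inj₂ (inj₁ (A~U , _)))          = ⊥-elim (trace-≤2 A w hyp A~⟦w⟧ U A~U (s≤s z≤n))
HasΨ-unique A w k hyp A~⟦w⟧ (inj₂ (inj₂ (inj₁ (A~U⁻¹ , _)))) = ⊥-elim (trace-≤2 A w hyp A~⟦w⟧ Uinv A~U⁻¹ (s≤s z≤n))
HasΨ-unique A w k hyp A~⟦w⟧ (inj₂ (inj₂ (inj₂ (es , _ , A~word , refl)))) = sym (sumSgn-Conj w es hyp (begin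
  ⟦ w ⟧               ≈⟨ A~⟦w⟧ ⟨
  A                   ≈⟨ A~word ⟩
  word es             ≈⟨ PEq⇒Conj (word-PEq es) ⟩
  S⁻¹ · ⟦ es ⟧ · S    ≈⟨ Conj-S ⟦ es ⟧ ⟩
  ⟦ es ⟧              ∎))
  where open import Relation.Binary.Reasoning.Setoid Conj-setoid

-- Continued fraction blocks as positive words

data EvenLength : List ℕ → Set where
  []   : EvenLength []
  cons₂ : ∀ {x y r} → EvenLength r → EvenLength (x ∷ y ∷ r)

EvenBlock : List ℕ → Set
EvenBlock e = EvenLength e × All (1 ≤_) e

EvenLength-++ : ∀ {e₁ e₂} → EvenLength e₁ → EvenLength e₂ → EvenLength (e₁ ++ e₂)
EvenLength-++ []          ev₂ = ev₂
EvenLength-++ (cons₂ ev₁) ev₂ = cons₂ (EvenLength-++ ev₁ ev₂)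

EvenBlock-^ : ∀ {y} j → EvenBlock y → EvenBlock (y ^ j)
EvenBlock-^ zero    _              = [] , []
EvenBlock-^ (suc j) blk@(ev , pos) =
  EvenLength-++ ev (proj₁ (EvenBlock-^ j blk)) , Allₚ.++⁺ pos (proj₂ (EvenBlock-^ j blk))

-- L^a₁ R^a₂ L^a₃ ⋯: the word of the continued fraction [a₁, a₂, …].
encode : List ℕ → List Letter
encode []          = []
encode (x ∷ [])    = replicate x L
encode (x ∷ y ∷ r) = replicate x L ++ replicate y R ++ encode r

encode-++ : ∀ {e₁} e₂ → EvenLength e₁ → encode (e₁ ++ e₂) ≡ encode e₁ ++ encode e₂
encode-++ e₂ [] = refl
encode-++ {x ∷ y ∷ r} e₂ (cons₂ ev) = begin
  Lˣ ++ Rʸ ++ encode (r ++ e₂)           ≡⟨ cong (λ u → Lˣ ++ Rʸ ++ u) (encode-++ e₂ ev) ⟩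
  Lˣ ++ Rʸ ++ encode r ++ encode e₂      ≡⟨ cong (Lˣ ++_) (Listₚ.++-assoc Rʸ (encode r) (encode e₂)) ⟨
  Lˣ ++ (Rʸ ++ encode r) ++ encode e₂    ≡⟨ Listₚ.++-assoc Lˣ (Rʸ ++ encode r) (encode e₂) ⟨
  encode (x ∷ y ∷ r) ++ encode e₂        ∎
  where
  open ≡-Reasoning
  Lˣ = replicate x L
  Rʸ = replicate y R

encode-^ : ∀ {y} j → EvenLength y → encode (y ^ j) ≡ encode y ^ j
encode-^ zero    _  = refl
encode-^ {y} (suc j) ev = trans (encode-++ (y ^ j) ev) (cong (encode y ++_) (encode-^ j ev))

⟦replicate-L⟧ : ∀ x → ⟦ replicate x L ⟧ ≡ mat 1ℤ 0ℤ (+ x) 1ℤ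
⟦replicate-L⟧ zero    = refl
⟦replicate-L⟧ (suc x) = trans (cong (letter L ·_) (⟦replicate-L⟧ x))
  (mat-cong refl refl (trans (shift (+ x)) (sym (ℤₚ.pos-+ 1 x))) refl)
  where
  shift : ∀ X → 1ℤ * 1ℤ + 1ℤ * X ≡ 1ℤ + X
  shift = solve-∀

⟦replicate-R⟧ : ∀ y → ⟦ replicate y R ⟧ ≡ mat 1ℤ (+ y) 0ℤ 1ℤ
⟦replicate-R⟧ zero    = refl
⟦replicate-R⟧ (suc y) = trans (cong (letter R ·_) (⟦replicate-R⟧ y))
  (mat-cong refl (trans (shift (+ y)) (sym (ℤₚ.pos-+ 1 y))) refl refl)
  where
  shift : ∀ Y → 1ℤ * Y + 1ℤ * 1ℤ ≡ 1ℤ + Y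
  shift = solve-∀

G·G : ∀ x y → G x · G y ≡ ⟦ replicate x L ⟧ · ⟦ replicate y R ⟧
G·G x y = trans (mat-cong refl (top (+ y)) (bottom (+ x)) (diagonal (+ x) (+ y)))
                (sym (cong₂ _·_ (⟦replicate-L⟧ x) (⟦replicate-R⟧ y)))
  where
  top : ∀ Y → 0ℤ * 1ℤ + 1ℤ * Y ≡ 1ℤ * Y + 0ℤ * 1ℤ
  top = solve-∀
  bottom : ∀ X → 1ℤ * 0ℤ + X * 1ℤ ≡ X * 1ℤ + 1ℤ * 0ℤ
  bottom = solve-∀
  diagonal : ∀ X Y → 1ℤ * 1ℤ + X * Y ≡ X * Y + 1ℤ * 1ℤ
  diagonal = solve-∀

cfMat-encode : ∀ e → EvenLength e → cfMat e ≡ ⟦ encode e ⟧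
cfMat-encode [] [] = refl
cfMat-encode (x ∷ y ∷ r) (cons₂ ev) = begin
  G x · (G y · cfMat r)             ≡⟨ ·-assoc (G x) (G y) (cfMat r) ⟨
  G x · G y · cfMat r               ≡⟨ cong₂ _·_ (G·G x y) (cfMat-encode r ev) ⟩
  ⟦ Lˣ ⟧ · ⟦ Rʸ ⟧ · ⟦ encode r ⟧     ≡⟨ ·-assoc ⟦ Lˣ ⟧ ⟦ Rʸ ⟧ ⟦ encode r ⟧ ⟩
  ⟦ Lˣ ⟧ · (⟦ Rʸ ⟧ · ⟦ encode r ⟧)   ≡⟨ cong (⟦ Lˣ ⟧ ·_) (⟦⟧-++ Rʸ (encode r)) ⟨
  ⟦ Lˣ ⟧ · ⟦ Rʸ ++ encode r ⟧        ≡⟨ ⟦⟧-++ Lˣ (Rʸ ++ encode r) ⟨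
  ⟦ encode (x ∷ y ∷ r) ⟧             ∎
  where
  open ≡-Reasoning
  Lˣ = replicate x L
  Rʸ = replicate y R

sumSgn-replicate-L : ∀ x → sumSgn (replicate x L) ≡ - + x
sumSgn-replicate-L zero    = refl
sumSgn-replicate-L (suc x) = trans (cong (λ s → - 1ℤ + s) (sumSgn-replicate-L x)) (step (+ x))
  where
  step : ∀ X → - 1ℤ + - X ≡ - (1ℤ + X)
  step = solve-∀

sumSgn-replicate-R : ∀ y → sumSgn (replicate y R) ≡ + y
sumSgn-replicate-R zero    = refl
sumSgn-replicate-R (suc y) = cong (λ s → 1ℤ + s) (sumSgn-replicate-R y)

alt-encode : ∀ e → alt e ≡ sumSgn (encode e)
alt-encode []          = refl
alt-encode (x ∷ [])    = sym (sumSgn-replicate-L x)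
alt-encode (x ∷ y ∷ r) = sym (begin
  sumSgn (Lˣ ++ Rʸ ++ encode r)                      ≡⟨ sumSgn-++ Lˣ (Rʸ ++ encode r) ⟩
  sumSgn Lˣ + sumSgn (Rʸ ++ encode r)                ≡⟨ cong (λ s → sumSgn Lˣ + s) (sumSgn-++ Rʸ (encode r)) ⟩
  sumSgn Lˣ + (sumSgn Rʸ + sumSgn (encode r))        ≡⟨ cong₂ (λ u v → u + (v + sumSgn (encode r)))
                                                              (sumSgn-replicate-L x) (sumSgn-replicate-R y) ⟩
  - + x + (+ y + sumSgn (encode r))                  ≡⟨ ℤₚ.+-assoc (- + x) (+ y) (sumSgn (encode r)) ⟨
  - + x + + y + sumSgn (encode r)                    ≡⟨ cong (λ s → - + x + + y + s) (alt-encode r) ⟨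
  - + x + + y + alt r                                ∎)
  where
  open ≡-Reasoning
  Lˣ = replicate x L
  Rʸ = replicate y R

StartsWith : Letter → List Letter → Set
StartsWith l t = Σ (List Letter) λ t₀ → t ≡ l ∷ t₀

EndsWithR : List Letter → Set
EndsWithR t = Σ (List Letter) λ t₀ → t ≡ t₀ ++ [ R ]

L≢R : L ≢ R
L≢R ()

R≢L : R ≢ L
R≢L ()

run-clash : ∀ {l l′ : Letter} → l ≢ l′ → ∀ n m k → replicate n l ≢ m ++ l′ ∷ k
run-clash l≢l′ zero    []      k ()
run-clash l≢l′ zero    (_ ∷ _) k ()
run-clash l≢l′ (suc n) []      k eq = l≢l′ (Listₚ.∷-injectiveˡ eq)
run-clash l≢l′ (suc n) (_ ∷ m) k eq = run-clash l≢l′ n m k (Listₚ.∷-injectiveʳ eq)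

runs-unique : ∀ l n n′ s s′ → replicate n l ++ s ≡ replicate n′ l ++ s′ →
              ¬ StartsWith l s → ¬ StartsWith l s′ → n ≡ n′ × s ≡ s′
runs-unique l zero    zero     s s′ eq _  _  = refl , eq
runs-unique l zero    (suc n′) s s′ eq ns _  = ⊥-elim (ns (_ , eq))
runs-unique l (suc n) zero     s s′ eq _  ns′ = ⊥-elim (ns′ (_ , sym eq))
runs-unique l (suc n) (suc n′) s s′ eq ns ns′ with runs-unique l n n′ s s′ (Listₚ.∷-injectiveʳ eq) ns ns′
... | refl , s≡s′ = refl , s≡s′

encode≡[] : ∀ {e} → EvenBlock e → encode e ≡ [] → e ≡ []
encode≡[] ([] , [])                    _ = refl
encode≡[] (cons₂ _ , s≤s _ ∷ _ ∷ _) ()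

encode-starts-L : ∀ {e} → EvenBlock e → e ≢ [] → StartsWith L (encode e)
encode-starts-L ([] , [])                    e≢[] = ⊥-elim (e≢[] refl)
encode-starts-L (cons₂ _ , s≤s _ ∷ _ ∷ _) _    = _ , refl

EndsWithR-++ : ∀ u {v} → EndsWithR v → EndsWithR (u ++ v)
EndsWithR-++ u (v₀ , refl) = u ++ v₀ , sym (Listₚ.++-assoc u v₀ [ R ])

EndsWithR-R-run : ∀ y → 1 ≤ y → EndsWithR (replicate y R)
EndsWithR-R-run (suc zero)    _ = [] , refl
EndsWithR-R-run (suc (suc y)) _ = EndsWithR-++ [ R ] (EndsWithR-R-run (suc y) (s≤s ℕ.z≤n))

encode-ends-R : ∀ {e} → EvenBlock e → e ≢ [] → EndsWithR (encode e)
encode-ends-R ([] , []) e≢[] = ⊥-elim (e≢[] refl)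
encode-ends-R {x ∷ y ∷ []} (cons₂ [] , _ ∷ py ∷ []) _ =
  EndsWithR-++ (replicate x L) (subst EndsWithR (sym (Listₚ.++-identityʳ (replicate y R))) (EndsWithR-R-run y py))
encode-ends-R {x ∷ y ∷ r@(_ ∷ _)} (cons₂ ev , _ ∷ _ ∷ pr) _ =
  EndsWithR-++ (replicate x L) (EndsWithR-++ (replicate y R) (encode-ends-R (ev , pr) (λ ())))

¬StartsWith-R-encode : ∀ {e} → EvenBlock e → ¬ StartsWith R (encode e)
¬StartsWith-R-encode ([] , [])                    (_ , ())
¬StartsWith-R-encode (cons₂ _ , s≤s _ ∷ _ ∷ _) (_ , ())

¬StartsWith-L-R-run : ∀ {y} s → 1 ≤ y → ¬ StartsWith L (replicate y R ++ s)
¬StartsWith-L-R-run s (s≤s _) (_ , ())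

encode-injective : ∀ {e e′} → EvenBlock e → EvenBlock e′ → encode e ≡ encode e′ → e ≡ e′
encode-injective ([] , []) blk′ eq = sym (encode≡[] blk′ (sym eq))
encode-injective blk ([] , []) eq = encode≡[] blk eq
encode-injective {x ∷ y ∷ r} {x′ ∷ y′ ∷ r′} (cons₂ ev , _ ∷ py ∷ pr) (cons₂ ev′ , _ ∷ py′ ∷ pr′) eq
  with runs-unique L x x′ _ _ eq (¬StartsWith-L-R-run (encode r) py) (¬StartsWith-L-R-run (encode r′) py′)
... | refl , eq₁ with runs-unique R y y′ _ _ eq₁ (¬StartsWith-R-encode (ev , pr)) (¬StartsWith-R-encode (ev′ , pr′))
...   | refl , eq₂ = cong (λ t → x ∷ y ∷ t) (encode-injective (ev , pr) (ev′ , pr′) eq₂)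

EndsWithR-suffix : ∀ a m t₀ → a ++ m ≡ t₀ ++ [ R ] → m ≢ [] → EndsWithR m
EndsWithR-suffix a m t₀ eq m≢[] with ++-overlap a m t₀ [ R ] eq
... | inj₁ (k , _ , m≡kR)        = k , m≡kR
... | inj₂ ([] , _ , R≡m)        = [] , sym R≡m
... | inj₂ (_ ∷ k , _ , R≡_∷k++m) = ⊥-elim (m≢[] (Listₚ.++-conicalʳ k m (sym (Listₚ.∷-injectiveʳ R≡_∷k++m))))

L-run-before-R : ∀ x s u₀ v → replicate x L ++ s ≡ (u₀ ++ [ R ]) ++ v →
                 Σ (List Letter) λ m → u₀ ++ [ R ] ≡ replicate x L ++ m × s ≡ m ++ v
L-run-before-R x s u₀ v eq with ++-overlap (replicate x L) s (u₀ ++ [ R ]) v eq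
... | inj₁ split = split
... | inj₂ (m , Lˣ≡uRm , _) = ⊥-elim (run-clash L≢R x u₀ m (trans Lˣ≡uRm (Listₚ.++-assoc u₀ [ R ] m)))

R-run-before-L : ∀ y s m v → replicate y R ++ s ≡ m ++ L ∷ v →
                 Σ (List Letter) λ m′ → m ≡ replicate y R ++ m′ × s ≡ m′ ++ L ∷ v
R-run-before-L y s m v eq with ++-overlap (replicate y R) s m (L ∷ v) eq
... | inj₁ split = split
... | inj₂ ([] , Rʸ≡m++[] , L∷v≡s) =
  [] , trans (sym (Listₚ.++-identityʳ m)) (trans (sym Rʸ≡m++[]) (sym (Listₚ.++-identityʳ (replicate y R)))) , sym L∷v≡s
... | inj₂ (l ∷ k , Rʸ≡m++lk , L∷v≡lks) with Listₚ.∷-injectiveˡ L∷v≡lks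
...   | refl = ⊥-elim (run-clash R≢L y m k Rʸ≡m++lk)

encode-pair : ∀ x y r {m m′ u} → u ≡ replicate x L ++ m → m ≡ replicate y R ++ m′ → encode r ≡ m′ →
              encode (x ∷ y ∷ r) ≡ u
encode-pair x y r u≡Lˣm m≡Rʸm′ r≡m′ = begin
  replicate x L ++ replicate y R ++ encode r   ≡⟨ cong (λ t → replicate x L ++ replicate y R ++ t) r≡m′ ⟩
  replicate x L ++ replicate y R ++ _          ≡⟨ cong (replicate x L ++_) m≡Rʸm′ ⟨
  replicate x L ++ _                           ≡⟨ u≡Lˣm ⟨
  _                                            ∎
  where open ≡-Reasoning

-- A cut of encode e after an R and before an L is a cut between two pairs of e.
encode-prefix : ∀ e → EvenBlock e → ∀ u v → encode e ≡ u ++ v → EndsWithR u → v ≡ [] ⊎ StartsWith L v →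
                Σ (List ℕ) λ e₁ → EvenBlock e₁ × encode e₁ ≡ u
encode-prefix e blk u v eq _ (inj₁ refl) = e , blk , trans eq (Listₚ.++-identityʳ u)
encode-prefix [] _ u v eq (u₀ , refl) (inj₂ (v₀ , refl))
  with Listₚ.++-conicalʳ (u₀ ++ [ R ]) (L ∷ v₀) (sym eq)
... | ()
encode-prefix (x ∷ y ∷ r) (cons₂ ev , px ∷ py ∷ pr) u v eq (u₀ , refl) (inj₂ (v₀ , refl))
  with L-run-before-R x (replicate y R ++ encode r) u₀ (L ∷ v₀) eq
... | m , u≡Lˣm , Rʸr≡mv with R-run-before-L y (encode r) m v₀ Rʸr≡mv
...   | [] , m≡Rʸ , _ = x ∷ y ∷ [] , (cons₂ [] , px ∷ py ∷ []) , encode-pair x y [] u≡Lˣm m≡Rʸ refl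
...   | m′@(_ ∷ _) , m≡Rʸm′ , r≡m′v
  with encode-prefix r (ev , pr) m′ (L ∷ v₀) r≡m′v
         (EndsWithR-suffix (replicate x L ++ replicate y R) m′ u₀ uR≡LˣRʸm′ (λ ())) (inj₂ (v₀ , refl))
  where
  uR≡LˣRʸm′ : (replicate x L ++ replicate y R) ++ m′ ≡ u₀ ++ [ R ]
  uR≡LˣRʸm′ = trans (Listₚ.++-assoc (replicate x L) (replicate y R) m′)
                    (trans (cong (replicate x L ++_) (sym m≡Rʸm′)) (sym u≡Lˣm))
...     | r₁ , (ev₁ , pr₁) , r₁≡m′ =
  x ∷ y ∷ r₁ , (cons₂ ev₁ , px ∷ py ∷ pr₁) , encode-pair x y r₁ u≡Lˣm m≡Rʸm′ r₁≡m′

StartsWith-L-^ : ∀ {t} j → StartsWith L t → t ^ j ≡ [] ⊎ StartsWith L (t ^ j)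
StartsWith-L-^ zero    _          = inj₁ refl
StartsWith-L-^ (suc j) (t₀ , refl) = inj₂ (t₀ ++ _ , refl)

-- Cutting encode e = t ^ j after its first factor t and comparing with encode y ^ j.
encode-power : ∀ {e} t j → EvenBlock e → e ≢ [] → encode e ≡ t ^ j →
               Σ (List ℕ) λ y → EvenBlock y × e ≡ y ^ j
encode-power t zero blk e≢[] eq = ⊥-elim (e≢[] (encode≡[] blk eq))
encode-power [] (suc j) blk e≢[] eq = ⊥-elim (e≢[] (encode≡[] blk (trans eq ([]^ (suc j)))))
encode-power {e} t@(l ∷ t₀) (suc j) blk e≢[] eq
  with encode-starts-L blk e≢[] | encode-ends-R blk e≢[]
... | s₀ , e≡Ls₀ | e₀ , e≡e₀R with Listₚ.∷-injectiveˡ (trans (sym eq) e≡Ls₀)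
...   | refl with encode-prefix e blk t (t ^ j) eq t-ends-R (StartsWith-L-^ j (t₀ , refl))
  where
  t-ends-R : EndsWithR t
  t-ends-R = EndsWithR-suffix (t ^ j) t e₀ (trans (sym (^-suc-comm j t)) (trans (sym eq) e≡e₀R)) (λ ())
...     | y , blk-y , y≡t = y , blk-y , encode-injective blk (EvenBlock-^ (suc j) blk-y) (begin
  encode e              ≡⟨ eq ⟩
  t ^ suc j             ≡⟨ cong (_^ suc j) y≡t ⟨
  encode y ^ suc j      ≡⟨ encode-^ (suc j) (proj₁ blk-y) ⟨
  encode (y ^ suc j)    ∎)
  where open ≡-Reasoning

-- The minimal even expansion

isEven-EvenLength : ∀ {e} → EvenLength e → isEven (length e) ≡ true
isEven-EvenLength []         = refl
isEven-EvenLength (cons₂ ev) = isEven-EvenLength ev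

EvenLength-isEven : ∀ e → isEven (length e) ≡ true → EvenLength e
EvenLength-isEven []          _  = []
EvenLength-isEven (x ∷ y ∷ r) ev = cons₂ (EvenLength-isEven r ev)

isEven-double : ∀ n → isEven (n ℕ.+ n) ≡ true
isEven-double zero    = refl
isEven-double (suc n) = trans (cong (λ m → isEven (suc m)) (ℕₚ.+-suc n n)) (isEven-double n)

data Parity (as : List ℕ) : Set where
  even : isEven (length as) ≡ true  → evenExp as ≡ as        → Parity as
  odd  : isEven (length as) ≡ false → evenExp as ≡ as ++ as  → Parity as

parity : ∀ as → Parity as
parity as with isEven (length as) in p
... | true  = even p (cong (λ b → if b then as else as ++ as) p)
... | false = odd p (cong (λ b → if b then as else as ++ as) p)

evenExp-block : ∀ as → All (1 ≤_) as → EvenBlock (evenExp as)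
evenExp-block as pos with parity as
... | even p e = subst EvenBlock (sym e) (EvenLength-isEven as p , pos)
... | odd  _ e = subst EvenBlock (sym e)
  (EvenLength-isEven (as ++ as) (trans (cong isEven (Listₚ.length-++ as)) (isEven-double (length as))) , Allₚ.++⁺ pos pos)

evenExp≢[] : ∀ as → as ≢ [] → evenExp as ≢ []
evenExp≢[] as as≢[] with parity as
... | even _ e = as≢[] ∘′ trans (sym e)
... | odd  _ e = as≢[] ∘′ Listₚ.++-conicalˡ as as ∘′ trans (sym e)

≤-half : ∀ {m n} → m ℕ.+ m ≤ n ℕ.+ n → m ≤ n
≤-half {m} {n} 2m≤2n with m ≤? n
... | yes m≤n = m≤n
... | no  m≰n = ⊥-elim (ℕₚ.<⇒≱ (ℕₚ.+-mono-< (ℕₚ.≰⇒> m≰n) (ℕₚ.≰⇒> m≰n)) 2m≤2n)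

-- If as·as = y^(k+2), then as = y·q with y·q = q·y, so y and q are powers of a common
-- word; minimality of as leaves q = [] (as then has the even length of y) or y = [].
square-primitive : ∀ as y j → as ≢ [] → MinimalBlock as → isEven (length as) ≡ false → EvenLength y →
                   as ++ as ≡ y ^ j → j ≡ 1
square-primitive as y zero    as≢[] _ _ _ eq = ⊥-elim (as≢[] (Listₚ.++-conicalˡ as as eq))
square-primitive as y (suc zero) _ _ _ _ _  = refl
square-primitive as y (suc (suc k)) as≢[] minimal isOdd ev eq
  with ++-prefix y (y ^ suc k) as as (sym eq) ∣y∣≤∣as∣
  where
  ∣y∣≤∣as∣ : length y ≤ length as
  ∣y∣≤∣as∣ = ≤-half (begin
    length y ℕ.+ length y            ≤⟨ ℕₚ.+-monoʳ-≤ (length y) (Listₚ.length-++-≤ˡ y) ⟩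
    length y ℕ.+ length (y ^ suc k)  ≡⟨ Listₚ.length-++ y ⟨
    length (y ^ suc (suc k))         ≡⟨ cong length eq ⟨
    length (as ++ as)                ≡⟨ Listₚ.length-++ as ⟩
    length as ℕ.+ length as          ∎)
    where open ℕₚ.≤-Reasoning
... | q , as≡yq , _
  with ++-comm⇒powers y q
         (++-comm-of-square y q (y ^ suc k) (^-suc-comm (suc k) y) (trans (cong₂ _++_ (sym as≡yq) (sym as≡yq)) eq))
... | t , α , β , y≡tᵅ , q≡tᵝ with minimal t (α ℕ.+ β) (trans as≡yq (trans (cong₂ _++_ y≡tᵅ q≡tᵝ) (^-+ α β t)))
square-primitive as y (suc (suc k)) as≢[] minimal isOdd ev eq | q , as≡yq , _ | t , zero , β , y≡[] , _ | _ =
  ⊥-elim (as≢[] (Listₚ.++-conicalˡ as as (trans eq (trans (cong (_^ suc (suc k)) y≡[]) ([]^ (suc (suc k)))))))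
square-primitive as y (suc (suc k)) as≢[] minimal isOdd ev eq | q , as≡yq , _ | t , suc zero , zero , _ , q≡[] | _ =
  ⊥-elim (true≢false (trans (sym (isEven-EvenLength ev)) (trans (cong (isEven ∘ length) as≡y) isOdd)))
  where
  true≢false : true ≢ false
  true≢false ()
  as≡y : y ≡ as
  as≡y = sym (trans as≡yq (trans (cong (y ++_) q≡[]) (Listₚ.++-identityʳ y)))
square-primitive as y (suc (suc k)) as≢[] minimal isOdd ev eq | q , as≡yq , _ | t , suc zero , suc β , _ , _ | ()
square-primitive as y (suc (suc k)) as≢[] minimal isOdd ev eq | q , as≡yq , _ | t , suc (suc α) , β , _ , _ | ()

evenExp-primitive : ∀ as y j → as ≢ [] → MinimalBlock as → EvenLength y → evenExp as ≡ y ^ j → j ≡ 1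
evenExp-primitive as y j as≢[] minimal ev eq with parity as
... | even _ e   = minimal y j (trans (sym e) eq)
... | odd isOdd e = square-primitive as y j as≢[] minimal isOdd ev (trans (sym e) eq)

encode-evenExp≢[] : ∀ as → as ≢ [] → All (1 ≤_) as → encode (evenExp as) ≢ []
encode-evenExp≢[] as as≢[] pos = evenExp≢[] as as≢[] ∘ encode≡[] (evenExp-block as pos)

-- Matrices with the oriented axis of the geodesic

difference : ∀ {x y m n} → x - y ≡ m - n → m ≡ n → x ≡ y
difference {x} {y} {m} eq refl = begin
  x                  ≡⟨ shift x y ⟩
  (x - y) + y        ≡⟨ cong (_+ y) eq ⟩
  (m - m) + y        ≡⟨ cancel m y ⟩
  y                  ∎
  where
  open ≡-Reasoning
  shift : ∀ x y → x ≡ (x - y) + y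
  shift = solve-∀
  cancel : ∀ m y → (m - m) + y ≡ y
  cancel = solve-∀

cross-multiply : ∀ u v {x y x′ y′} → + suc u * x ≡ v * x′ → + suc u * y ≡ v * y′ → x * y′ ≡ x′ * y
cross-multiply u v {x} {y} {x′} {y′} ux≡vx′ uy≡vy′ = ℤₚ.*-cancelˡ-≡ (+ suc u) _ _ (begin
  + suc u * (x * y′)      ≡⟨ ℤₚ.*-assoc (+ suc u) x y′ ⟨
  + suc u * x * y′        ≡⟨ cong (_* y′) ux≡vx′ ⟩
  v * x′ * y′             ≡⟨ swap v x′ y′ ⟩
  x′ * (v * y′)           ≡⟨ cong (x′ *_) uy≡vy′ ⟨
  x′ * (+ suc u * y)      ≡⟨ swap′ x′ (+ suc u) y ⟩
  + suc u * (x′ * y)      ∎)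
  where
  open ≡-Reasoning
  swap : ∀ v x′ y′ → v * x′ * y′ ≡ x′ * (v * y′)
  swap = solve-∀
  swap′ : ∀ x′ u y → x′ * (u * y) ≡ u * (x′ * y)
  swap′ = solve-∀

-- The commutator X Y - Y X has the 2×2 minors of the coefficient vectors (c, d - a, b)
-- of the fixed point polynomials as entries, and those vanish for proportional vectors.
proportional⇒commute : ∀ u v X Y → 0 ℕ.< u →
  + u * c X ≡ + v * c Y → + u * (d X - a X) ≡ + v * (d Y - a Y) → + u * b X ≡ + v * b Y →
  X · Y ≡ Y · X
proportional⇒commute (suc u) v (mat a b c d) (mat e f g h) _ c∥ d-a∥ b∥ = mat-cong
  (difference (entry₁ a b c e f g) (cross-multiply u (+ v) b∥ c∥))
  (difference (entry₂ a b d e f h) (cross-multiply u (+ v) b∥ d-a∥))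
  (difference (entry₃ a c d e g h) (sym (cross-multiply u (+ v) c∥ d-a∥)))
  (difference (entry₄ b c d f g h) (cross-multiply u (+ v) c∥ b∥))
  where
  entry₁ : ∀ a b c e f g → (a * e + b * g) - (e * a + f * c) ≡ b * g - f * c
  entry₁ = solve-∀
  entry₂ : ∀ a b d e f h → (a * f + b * h) - (e * b + f * d) ≡ b * (h - e) - f * (d - a)
  entry₂ = solve-∀
  entry₃ : ∀ a c d e g h → (c * e + d * g) - (g * a + h * c) ≡ g * (d - a) - c * (h - e)
  entry₃ = solve-∀
  entry₄ : ∀ b c d f g h → (c * f + d * h) - (g * b + h * d) ≡ c * f - g * b
  entry₄ = solve-∀

nonneg-proportional : ∀ u v x n → 0 ℕ.< u → + u * x ≡ + v * + n → 0ℤ ℤ.≤ x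
nonneg-proportional u       v (+ m)      n _ _  = +≤+ z≤n
nonneg-proportional (suc u) v -[1+ m ] n _ eq with trans eq (sym (ℤₚ.pos-* v n))
... | ()

-- a d = 1 + b c > 0 forces a and d to have the same sign, which the trace fixes.
unimodular-diagonal-nonneg : ∀ a b c d → 0ℤ ℤ.≤ b → 0ℤ ℤ.≤ c → a * d - b * c ≡ 1ℤ → 0ℤ ℤ.< a + d →
                             0ℤ ℤ.≤ a × 0ℤ ℤ.≤ d
unimodular-diagonal-nonneg (+ x)    b c (+ y)    _   _   _     _ = +≤+ z≤n , +≤+ z≤n
unimodular-diagonal-nonneg -[1+ x ] b c -[1+ y ] _   _   _     ()
unimodular-diagonal-nonneg -[1+ x ] b c (+ y)    0≤b 0≤c det≡1 _ = ⊥-elim (det≢1 -[1+ x ] b c (+ y)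
  (subst (ℤ._≤ 0ℤ) (ℤₚ.*-comm (+ y) -[1+ x ]) (nonneg*nonpos≤0 {+ y} { -[1+ x ]} (+≤+ z≤n) -≤+)) (0≤* 0≤b 0≤c) det≡1)
unimodular-diagonal-nonneg (+ x)    b c -[1+ y ] 0≤b 0≤c det≡1 _ = ⊥-elim (det≢1 (+ x) b c -[1+ y ]
  (nonneg*nonpos≤0 {+ x} { -[1+ y ]} (+≤+ z≤n) -≤+) (0≤* 0≤b 0≤c) det≡1)

det-signed : ∀ σ A → det (signed σ A) ≡ det A
det-signed pl A = refl
det-signed mi A = det-neg A

PEq-signed : ∀ σ A → PEq A (signed σ A)
PEq-signed pl A = inj₁ refl
PEq-signed mi A = inj₂ (sym (neg-involutive A))

⟦⟧-^ : ∀ t n → ⟦ t ^ n ⟧ ≡ pow ⟦ t ⟧ n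
⟦⟧-^ t zero    = refl
⟦⟧-^ t (suc n) = trans (⟦⟧-++ t (t ^ n)) (cong (⟦ t ⟧ ·_) (⟦⟧-^ t n))

-- The sign representative with positive trace is a nonnegative matrix commuting with ⟦ W ⟧.
sameAxis-⟦⟧ : ∀ A W → det A ≡ 1ℤ → SameOrientedAxis A ⟦ W ⟧ →
              Σ Sgn λ σ → Σ (List Letter) λ V → ⟦ V ⟧ ≡ signed σ A × V ++ W ≡ W ++ V
sameAxis-⟦⟧ A W det≡1 (σ , 0<tr , u , v , 0<u , _ , c∥ , d-a∥ , b∥) = σ , V , ⟦V⟧≡A′ ,
  ⟦⟧-injective (V ++ W) (W ++ V) (begin
    ⟦ V ++ W ⟧     ≡⟨ ⟦⟧-++ V W ⟩
    ⟦ V ⟧ · ⟦ W ⟧   ≡⟨ cong (_· ⟦ W ⟧) ⟦V⟧≡A′ ⟩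
    A′ · ⟦ W ⟧      ≡⟨ proportional⇒commute u v A′ ⟦ W ⟧ 0<u c∥ d-a∥ b∥ ⟩
    ⟦ W ⟧ · A′      ≡⟨ cong (⟦ W ⟧ ·_) ⟦V⟧≡A′ ⟨
    ⟦ W ⟧ · ⟦ V ⟧   ≡⟨ ⟦⟧-++ W V ⟨
    ⟦ W ++ V ⟧     ∎)
  where
  open ≡-Reasoning
  A′ : M2
  A′ = signed σ A
  det-A′ : det A′ ≡ 1ℤ
  det-A′ = trans (det-signed σ A) det≡1
  0≤b : 0ℤ ℤ.≤ b A′
  0≤b = nonneg-proportional u v (b A′) (ℕMat.q ⟦ W ⟧ℕ) 0<u (trans b∥ (cong (λ Z → + v * b Z) (sym (toℤ-⟦⟧ℕ W))))
  0≤c : 0ℤ ℤ.≤ c A′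
  0≤c = nonneg-proportional u v (c A′) (ℕMat.r ⟦ W ⟧ℕ) 0<u (trans c∥ (cong (λ Z → + v * c Z) (sym (toℤ-⟦⟧ℕ W))))
  0≤a×0≤d : 0ℤ ℤ.≤ a A′ × 0ℤ ℤ.≤ d A′
  0≤a×0≤d = unimodular-diagonal-nonneg (a A′) (b A′) (c A′) (d A′) 0≤b 0≤c det-A′ 0<tr
  positive : Σ (List Letter) λ V → ⟦ V ⟧ ≡ A′
  positive = nonneg-unimodular⇒⟦⟧ A′ det-A′ ((proj₁ 0≤a×0≤d , 0≤b) , (0≤c , proj₂ 0≤a×0≤d))
  V : List Letter
  V = proj₁ positive
  ⟦V⟧≡A′ : ⟦ V ⟧ ≡ A′
  ⟦V⟧≡A′ = proj₂ positive

-- Both ⟦ V ⟧ = ±A and the word of evenExp as are powers of a common word t; primitivity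
-- of A and minimality of as make both exponents 1.
sameAxis-evenExp : ∀ as → as ≢ [] → All (1 ≤_) as → MinimalBlock as →
                   ∀ A → det A ≡ 1ℤ → Primitive A → SameOrientedAxis A (cfMat (evenExp as)) →
                   PEq A ⟦ encode (evenExp as) ⟧
sameAxis-evenExp as as≢[] pos minimal A det≡1 prim axis =
  let (σ , V , ⟦V⟧≡A′ , VW≡WV) =
        sameAxis-⟦⟧ A W det≡1 (subst (SameOrientedAxis A) (cfMat-encode e (proj₁ blk)) axis)
      (t , i , j , V≡tⁱ , W≡tʲ) = ++-comm⇒powers V W VW≡WV
      (y , (ev-y , _) , e≡yʲ) = encode-power t j blk (evenExp≢[] as as≢[]) W≡tʲ
      i≡1 : i ≡ 1
      i≡1 = prim ⟦ t ⟧ i (det-⟦⟧ t)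
              (PEq-trans (PEq-signed σ A) (inj₁ (trans (sym ⟦V⟧≡A′) (trans (cong ⟦_⟧ V≡tⁱ) (⟦⟧-^ t i)))))
      j≡1 : j ≡ 1
      j≡1 = evenExp-primitive as y j as≢[] minimal ev-y e≡yʲ
  in PEq-trans (PEq-signed σ A) (inj₁ (begin
    signed σ A    ≡⟨ ⟦V⟧≡A′ ⟨
    ⟦ V ⟧         ≡⟨ cong ⟦_⟧ V≡tⁱ ⟩
    ⟦ t ^ i ⟧     ≡⟨ cong (λ n → ⟦ t ^ n ⟧) (trans i≡1 (sym j≡1)) ⟩
    ⟦ t ^ j ⟧     ≡⟨ cong ⟦_⟧ W≡tʲ ⟨
    ⟦ W ⟧         ∎))
  where
  open ≡-Reasoning
  e : List ℕ
  e = evenExp as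
  blk : EvenBlock e
  blk = evenExp-block as pos
  W : List Letter
  W = encode e

-- The reflection z ↦ -z̄

reflect-· : ∀ X Y → reflect (X · Y) ≡ reflect X · reflect Y
reflect-· (mat a b c d) (mat e f g h) = mat-cong (e₁ a b e g) (e₂ a b f h) (e₃ c d e g) (e₄ c d f h)
  where
  e₁ : ∀ a b e g → a * e + b * g ≡ a * e + (- b) * (- g)
  e₁ = solve-∀
  e₂ : ∀ a b f h → - (a * f + b * h) ≡ a * (- f) + (- b) * h
  e₂ = solve-∀
  e₃ : ∀ c d e g → - (c * e + d * g) ≡ (- c) * e + d * (- g)
  e₃ = solve-∀
  e₄ : ∀ c d f h → c * f + d * h ≡ (- c) * (- f) + d * h
  e₄ = solve-∀

reflect-involutive : ∀ X → reflect (reflect X) ≡ X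
reflect-involutive (mat a b c d) = mat-cong refl (ℤₚ.neg-involutive b) (ℤₚ.neg-involutive c) refl

det-reflect : ∀ X → det (reflect X) ≡ det X
det-reflect (mat a b c d) = identity a b c d
  where
  identity : ∀ a b c d → a * d - (- b) * (- c) ≡ a * d - b * c
  identity = solve-∀

reflect-pow : ∀ B k → reflect (pow B k) ≡ pow (reflect B) k
reflect-pow B zero    = refl
reflect-pow B (suc k) = trans (reflect-· B (pow B k)) (cong (reflect B ·_) (reflect-pow B k))

PEq-reflect : ∀ {X Y} → PEq X Y → PEq (reflect X) (reflect Y)
PEq-reflect (inj₁ refl) = inj₁ refl
PEq-reflect (inj₂ refl) = inj₂ refl

Primitive-reflect : ∀ A → Primitive A → Primitive (reflect A)
Primitive-reflect A prim B k det≡1 A′≈Bᵏ = prim (reflect B) k (trans (det-reflect B) det≡1)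
  (PEq-trans (inj₁ (sym (reflect-involutive A)))
    (PEq-trans (PEq-reflect A′≈Bᵏ) (inj₁ (reflect-pow B k))))

reflect-signed : ∀ σ A → reflect (signed σ A) ≡ signed σ (reflect A)
reflect-signed pl A = refl
reflect-signed mi A = refl

SameOrientedAxis-reflect : ∀ A M → SameOrientedAxis A (reflect M) → SameOrientedAxis (reflect A) M
SameOrientedAxis-reflect A M (σ , 0<tr , u , v , 0<u , 0<v , c∥ , d-a∥ , b∥) =
  σ , subst (λ Z → 0ℤ ℤ.< tr Z) A′ 0<tr , u , v , 0<u , 0<v ,
  subst (λ Z → + u * c Z ≡ + v * c M) A′ (negate u v c∥) ,
  subst (λ Z → + u * (d Z - a Z) ≡ + v * (d M - a M)) A′ d-a∥ ,
  subst (λ Z → + u * b Z ≡ + v * b M) A′ (negate u v b∥)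
  where
  A′ : reflect (signed σ A) ≡ signed σ (reflect A)
  A′ = reflect-signed σ A
  negate : ∀ u v {x y} → + u * x ≡ + v * (- y) → + u * (- x) ≡ + v * y
  negate u v {x} {y} eq = begin
    + u * (- x)      ≡⟨ ℤₚ.neg-distribʳ-* (+ u) x ⟨
    - (+ u * x)      ≡⟨ cong -_ eq ⟩
    - (+ v * (- y))  ≡⟨ cong -_ (ℤₚ.neg-distribʳ-* (+ v) y) ⟨
    - - (+ v * y)    ≡⟨ ℤₚ.neg-involutive (+ v * y) ⟩
    + v * y          ∎
    where open ≡-Reasoning

reflect-⟦⟧ : ∀ w → reflect ⟦ w ⟧ ≡ S⁻¹ · ⟦ map mirror w ⟧ · S
reflect-⟦⟧ []      = refl
reflect-⟦⟧ (l ∷ w) = begin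
  reflect (letter l · ⟦ w ⟧)                                    ≡⟨ reflect-· (letter l) ⟦ w ⟧ ⟩
  reflect (letter l) · reflect ⟦ w ⟧                            ≡⟨ cong₂ _·_ (reflect-letter l) (reflect-⟦⟧ w) ⟩
  (S⁻¹ · letter (mirror l) · S) · (S⁻¹ · ⟦ map mirror w ⟧ · S)  ≡⟨ conj-·-distrib S S⁻¹ (letter (mirror l)) ⟦ map mirror w ⟧ refl ⟩
  S⁻¹ · ⟦ map mirror (l ∷ w) ⟧ · S                              ∎
  where
  open ≡-Reasoning
  reflect-letter : ∀ l → reflect (letter l) ≡ S⁻¹ · letter (mirror l) · S
  reflect-letter L = refl
  reflect-letter R = refl

sumSgn-mirror : ∀ w → sumSgn (map mirror w) ≡ - sumSgn w
sumSgn-mirror []      = refl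
sumSgn-mirror (L ∷ w) = trans (cong (λ s → 1ℤ + s) (sumSgn-mirror w)) (flip (sumSgn w))
  where
  flip : ∀ s → 1ℤ + - s ≡ - (- 1ℤ + s)
  flip = solve-∀
sumSgn-mirror (R ∷ w) = trans (cong (λ s → - 1ℤ + s) (sumSgn-mirror w)) (flip (sumSgn w))
  where
  flip : ∀ s → - 1ℤ + - s ≡ - (1ℤ + s)
  flip = solve-∀

∣sumSgn-mirror∣ : ∀ w → ∣ sumSgn (map mirror w) ∣ ≡ ∣ sumSgn w ∣
∣sumSgn-mirror∣ w = trans (cong ∣_∣ (sumSgn-mirror w)) (ℤₚ.∣-i∣≡∣i∣ (sumSgn w))

geodesic-word : ∀ as → as ≢ [] → All (1 ≤_) as → MinimalBlock as →
                ∀ bar A → det A ≡ 1ℤ → Primitive A → SameOrientedAxis A (geodesicMat bar as) →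
                Σ (List Letter) λ w → w ≢ [] × Conj A ⟦ w ⟧ × ∣ sumSgn w ∣ ≡ ∣ alt (evenExp as) ∣
geodesic-word as as≢[] pos minimal false A det≡1 prim axis =
  W , encode-evenExp≢[] as as≢[] pos , PEq⇒Conj (sameAxis-evenExp as as≢[] pos minimal A det≡1 prim axis) ,
  cong ∣_∣ (sym (alt-encode (evenExp as)))
  where W = encode (evenExp as)
geodesic-word as as≢[] pos minimal true A det≡1 prim axis =
  map mirror W , encode-evenExp≢[] as as≢[] pos ∘ map≡[] , A~⟦W̄⟧ ,
  trans (∣sumSgn-mirror∣ W) (cong ∣_∣ (sym (alt-encode (evenExp as))))
  where
  open import Relation.Binary.Reasoning.Setoid Conj-setoid
  W = encode (evenExp as)
  map≡[] : ∀ {w} → map mirror w ≡ [] → w ≡ []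
  map≡[] {[]} _ = refl
  reflect-A≈⟦W⟧ : PEq (reflect A) ⟦ W ⟧
  reflect-A≈⟦W⟧ = sameAxis-evenExp as as≢[] pos minimal (reflect A) (trans (det-reflect A) det≡1)
    (Primitive-reflect A prim) (SameOrientedAxis-reflect A (cfMat (evenExp as)) axis)
  A~⟦W̄⟧ : Conj A ⟦ map mirror W ⟧
  A~⟦W̄⟧ = begin
    A                            ≡⟨ reflect-involutive A ⟨
    reflect (reflect A)          ≈⟨ PEq⇒Conj (PEq-reflect reflect-A≈⟦W⟧) ⟩
    reflect ⟦ W ⟧                ≡⟨ reflect-⟦⟧ W ⟩
    S⁻¹ · ⟦ map mirror W ⟧ · S   ≈⟨ Conj-S ⟦ map mirror W ⟧ ⟩
    ⟦ map mirror W ⟧             ∎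

proposition3p2 : (as : List ℕ) → ¬ (as ≡ []) → All (1 ≤_) as → MinimalBlock as →
    (bar : Bool) (A : M2) → det A ≡ 1ℤ → Hyperbolic A → Primitive A →
    SameOrientedAxis A (geodesicMat bar as) →
    (Σ ℤ λ k → HasΨ A k) ×
    ((k : ℤ) → HasΨ A k → ∣ k ∣ ≡ ∣ alt (evenExp as) ∣)
proposition3p2 as as≢[] pos minimal bar A det≡1 hyperbolic prim axis =
  let (w , w≢[] , A~⟦w⟧ , ∣w∣≡∣alt∣) = geodesic-word as as≢[] pos minimal bar A det≡1 prim axis
      hyperbolic-w = subst (2 ℕ.<_) (∣tr∣-Conj {A} {⟦ w ⟧} A~⟦w⟧) hyperbolic
  in (sumSgn w , HasΨ-⟦⟧ A w w≢[] A~⟦w⟧) ,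
     λ k Ψ≡k → trans (cong ∣_∣ (HasΨ-unique A w k hyperbolic-w A~⟦w⟧ Ψ≡k)) ∣w∣≡∣alt∣
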